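{- For all integers $n\ge3$, $\operatorname{th_{edim}}(C_n)=2\sqrt{\tfrac{2n}{3}}\,(1\pm o(1))$ and $\operatorname{th_{edim}}(P_n)=2\sqrt{\tfrac{2}{3}n}\,(1\pm o(1))$ as $n\to\infty$.
   Context: $C_n$ and $P_n$ are the cycle and path on $n$ vertices. $\operatorname{dist}(u,v)$ is the shortest-path distance. For an edge $e=\{u,w\}$ and vertex $v$, $\operatorname{dist}(e,v)=\min(\operatorname{dist}(u,v),\operatorname{dist}(w,v))$; for a nonnegative integer $r$, $\operatorname{dist}_r(e,v)=\min(\operatorname{dist}(e,v),r+1)$. A set $S\subseteq V(G)$ is a distance-$r$ edge resolving set if for all distinct edges $e,f$ there is $v\in S$ with $\operatorname{dist}_r(v,e)\ne\operatorname{dist}_r(v,f)$. $\operatorname{edim}_r(G)$ is the minimum size of such a set and $\operatorname{th_{edim}}(G)=\min_{r\ge0}(r+\operatorname{edim}_r(G))$ over nonnegative integers $r$. -}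

module Defs where

open import Data.Nat using (ℕ; zero; suc; _+_; _*_; _∸_; _^_; _≤_; _<_; _⊓_)
open import Data.Fin using (Fin; toℕ)
import Data.Fin as F
open import Data.Fin.Subset using (Subset; _∈_; ∣_∣)
open import Data.Product using (Σ; _×_; _,_; ∃-syntax)
open import Data.Sum using (_⊎_)
open import Relation.Binary.PropositionalEquality using (_≡_; _≢_)
open import Relation.Nullary using (¬_)

Graph : ℕ → Set₁
Graph n = Fin n → Fin n → Set

cycleG : (n : ℕ) → Graph n
cycleG n u v =
  (toℕ v ≡ suc (toℕ u)) ⊎ (toℕ u ≡ suc (toℕ v)) ⊎
  ((toℕ u ≡ 0 × suc (toℕ v) ≡ n) ⊎ (toℕ v ≡ 0 × suc (toℕ u) ≡ n))

pathG : (n : ℕ) → Graph n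
pathG n u v = (toℕ v ≡ suc (toℕ u)) ⊎ (toℕ u ≡ suc (toℕ v))

Reach : ∀ {n} → Graph n → ℕ → Fin n → Fin n → Set
Reach G zero    u v = u ≡ v
Reach G (suc d) u v = Reach G d u v ⊎ (∃[ w ] (Reach G d u w × G w v))

-- TDist G r u v d : d = dist_r(u,v) = min(dist(u,v), r+1).
TDist : ∀ {n} → Graph n → ℕ → Fin n → Fin n → ℕ → Set
TDist G r u v d =
  (d ≤ suc r) × ((d ≤ r → Reach G d u v) × (∀ d' → d' < d → ¬ Reach G d' u v))

record Edge {n : ℕ} (G : Graph n) : Set where
  constructor edge
  field
    lo  : Fin n
    hi  : Fin n
    lt  : lo F.< hi
    adj : G lo hi

open Edge public

DistinctEdges : ∀ {n} {G : Graph n} → Edge G → Edge G → Set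
DistinctEdges e f = ¬ ((lo e ≡ lo f) × (hi e ≡ hi f))

-- EDist G r e v d : d = dist_r(e,v) = min(dist(e,v), r+1)
--   = min(dist_r(lo e, v), dist_r(hi e, v)).
EDist : ∀ {n} (G : Graph n) → ℕ → Edge G → Fin n → ℕ → Set
EDist G r e v d =
  ∃[ d₁ ] ∃[ d₂ ] (TDist G r v (lo e) d₁ × TDist G r v (hi e) d₂ × d ≡ d₁ ⊓ d₂)

EdgeResolving : ∀ {n} (G : Graph n) → ℕ → Subset n → Set
EdgeResolving {n} G r S =
  (e f : Edge G) → DistinctEdges e f →
  ∃[ v ] (v ∈ S × ∃[ d₁ ] ∃[ d₂ ] (EDist G r e v d₁ × EDist G r f v d₂ × d₁ ≢ d₂))

IsEdim : ∀ {n} (G : Graph n) → ℕ → ℕ → Set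
IsEdim {n} G r k =
  (∃[ S ] (EdgeResolving G r S × ∣ S ∣ ≡ k)) ×
  ((S : Subset n) → EdgeResolving G r S → k ≤ ∣ S ∣)

IsThEdim : ∀ {n} (G : Graph n) → ℕ → Set
IsThEdim G t =
  (∃[ r ] ∃[ k ] (IsEdim G r k × t ≡ r + k)) ×
  (∀ r k → IsEdim G r k → t ≤ r + k)

-- With ε = 1/(k+1):  (1-ε)·2√(2n/3) ≤ t ≤ (1+ε)·2√(2n/3), squared and cleared of denominators
-- (all quantities are nonnegative, (1-ε) = k/(k+1), (1+ε) = (k+2)/(k+1)).
WithinFactor : ℕ → ℕ → ℕ → Set
WithinFactor k n t =
  (3 * (suc k ^ 2) * (t ^ 2) ≤ 8 * (suc (suc k) ^ 2) * n) ×
  (8 * (k ^ 2) * n ≤ 3 * (suc k ^ 2) * (t ^ 2))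

{-# OPTIONS --safe #-}

-- Number the m edges of the graph along the line or the cycle (m = n for C_n, m = n - 1 for P_n) and
-- put L = r + 1.  A landmark sees at most two edges at each truncated distance d < L.  If S is a
-- distance-r edge resolving set, at most one edge is seen by no landmark and at most L∣S∣ edges by
-- exactly one, so double counting the pairs (edge, landmark seeing it) gives 2m ≤ 3L∣S∣ + 2, and
-- AM-GM turns this into 8n ≤ 3(r + ∣S∣ + 1)² + 16, that is r + ∣S∣ ≥ 2√(2n/3) - O(1).  Conversely,
-- cutting the edges into blocks of 3L consecutive edges and placing two landmarks at distance L and
-- 2L from the start of each block resolves all edges; with L = 2h and h ≈ √(n/6) this gives
-- r + ∣S∣ ≤ 4h + 5 = 2√(2n/3) + O(1).

module Submission where

open import Defs
open import Data.Nat using (ℕ; _≤_)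
open import Data.Product using (Σ; _×_; ∃-syntax)

open import Data.Bool using (if_then_else_)
open import Data.Empty using (⊥-elim)
open import Data.Fin as Fin using (Fin; zero; suc; toℕ; fromℕ<)
import Data.Fin.Properties as Finₚ
open import Data.Fin.Properties using (toℕ-injective; toℕ-fromℕ<; toℕ<n; any?; all?)
  renaming (_≟_ to _≟ᶠ_)
open import Data.Fin.Subset using (Subset; _∈_; ∣_∣; _∪_; ⁅_⁆; inside; outside)
  renaming (⊥ to ∅)
open import Data.Fin.Subset.Properties
  using (_∈?_; anySubset?; x∈⁅x⁆; p⊆p∪q; q⊆p∪q; ∣⊥∣≡0; ∣⁅x⁆∣≡1)
open import Data.Nat
open import Data.Nat.Properties
open import Data.Nat.DivMod using (_/_; _%_; m/n*n≤m; m<n*o⇒m/o<n; m≡m%n+[m/n]*n; m%n<n)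
open import Algebra.Properties.CommutativeSemigroup ⊓-commutativeSemigroup
  using () renaming (interchange to ⊓-interchange)
open import Algebra.Properties.Semiring.Sum +-*-semiring
  using (sum; sum-syntax; sum-cong-≗; sum-replicate-zero; ∑-distrib-+; ∑-comm; *-distribˡ-sum)
open import Data.Nat.Tactic.RingSolver using (solve-∀)
open import Data.Product using (_,_; proj₁; proj₂)
open import Data.Sum using (_⊎_; inj₁; inj₂; [_,_]′)
open import Data.Vec using (_∷_; [])
open import Function.Base using (_∘_)
open import Level using (Level)
open import Relation.Binary.PropositionalEquality
open import Relation.Nullary using (Dec; yes; no; does; ¬_)
open import Relation.Nullary.Decidable using (_×-dec_; _⊎-dec_; _→-dec_; ¬?; map′)

private
  variable
    ℓ ℓ′ ℓ″ : Level
    A : Set ℓ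
    B : Set ℓ′
    C : Set ℓ″

-- Defined through does rather than by matching on yes/no, so that 𝟙 (map′ f g A?) reduces to 𝟙 A?.
𝟙 : Dec A → ℕ
𝟙 A? = if does A? then 1 else 0

𝟙-yes : (A? : Dec A) → A → 𝟙 A? ≡ 1
𝟙-yes (yes _) _ = refl
𝟙-yes (no ¬a) a = ⊥-elim (¬a a)

𝟙-no : (A? : Dec A) → ¬ A → 𝟙 A? ≡ 0
𝟙-no (yes a) ¬a = ⊥-elim (¬a a)
𝟙-no (no _) _ = refl

𝟙≤ : ∀ {k} (A? : Dec A) → (A → 1 ≤ k) → 𝟙 A? ≤ k
𝟙≤ (yes a) 1≤k = 1≤k a
𝟙≤ (no _) _ = z≤n

𝟙≤𝟙+𝟙 : (A? : Dec A) (B? : Dec B) (C? : Dec C) → (A → B ⊎ C) → 𝟙 A? ≤ 𝟙 B? + 𝟙 C?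
𝟙≤𝟙+𝟙 A? B? C? A⇒B⊎C = 𝟙≤ A? (λ a → by-side (A⇒B⊎C a))
  where
  by-side : _ ⊎ _ → 1 ≤ 𝟙 B? + 𝟙 C?
  by-side (inj₁ b) = ≤-trans (≤-reflexive (sym (𝟙-yes B? b))) (m≤m+n _ _)
  by-side (inj₂ c) = ≤-trans (≤-reflexive (sym (𝟙-yes C? c))) (m≤n+m _ _)

𝟙-pos : (A? : Dec A) → 1 ≤ 𝟙 A? → A
𝟙-pos (yes a) _ = a

∑-mono-≤ : ∀ {m} {f g : Fin m → ℕ} → (∀ i → f i ≤ g i) → sum f ≤ sum g
∑-mono-≤ {zero} f≤g = z≤n
∑-mono-≤ {suc m} f≤g = +-mono-≤ (f≤g zero) (∑-mono-≤ (f≤g ∘ suc))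

∑-const : ∀ m c → ∑[ i < m ] c ≡ m * c
∑-const zero c = refl
∑-const (suc m) c = cong (c +_) (∑-const m c)

∑-zero : ∀ {m} {f : Fin m → ℕ} → (∀ i → f i ≡ 0) → sum f ≡ 0
∑-zero {m} f≡0 = trans (sum-cong-≗ f≡0) (sum-replicate-zero m)

f[i]≤∑f : ∀ {m} (f : Fin m → ℕ) i → f i ≤ sum f
f[i]≤∑f f zero = m≤m+n _ _
f[i]≤∑f f (suc i) = ≤-trans (f[i]≤∑f (f ∘ suc) i) (m≤n+m _ _)

f[i]+f[j]≤∑f : ∀ {m} (f : Fin m → ℕ) {i j} → i ≢ j → f i + f j ≤ sum f
f[i]+f[j]≤∑f f {zero} {zero} i≢j = ⊥-elim (i≢j refl)
f[i]+f[j]≤∑f f {zero} {suc j} _ = +-monoʳ-≤ (f zero) (f[i]≤∑f (f ∘ suc) j)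
f[i]+f[j]≤∑f f {suc i} {zero} _ =
  subst (_≤ sum f) (+-comm (f zero) (f (suc i))) (+-monoʳ-≤ (f zero) (f[i]≤∑f (f ∘ suc) i))
f[i]+f[j]≤∑f f {suc i} {suc j} i≢j =
  ≤-trans (f[i]+f[j]≤∑f (f ∘ suc) (i≢j ∘ cong suc)) (m≤n+m _ _)

∑-pos : ∀ {m} (f : Fin m → ℕ) → 1 ≤ sum f → ∃[ i ] 1 ≤ f i
∑-pos {suc m} f 1≤∑f with f zero in eq
... | suc _ = zero , subst (1 ≤_) (sym eq) (s≤s z≤n)
... | zero with ∑-pos (f ∘ suc) 1≤∑f
...   | i , 1≤fi = suc i , 1≤fi

∑𝟙≤1 : ∀ {m} {P : Fin m → Set ℓ} (P? : ∀ i → Dec (P i)) →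
       (∀ {i j} → P i → P j → i ≡ j) → ∑[ i < m ] 𝟙 (P? i) ≤ 1
∑𝟙≤1 {m = zero} P? unique = z≤n
∑𝟙≤1 {m = suc m} P? unique with P? zero
... | yes P0 = s≤s (≤-reflexive (∑-zero (λ i → 𝟙-no (P? (suc i)) (λ Pi → Finₚ.0≢1+n (unique P0 Pi)))))
... | no _ = ∑𝟙≤1 (P? ∘ suc) (λ Pi Pj → Finₚ.suc-injective (unique Pi Pj))

∣p∣≡∑𝟙∈ : ∀ {n} (S : Subset n) → ∣ S ∣ ≡ ∑[ v < n ] 𝟙 (v ∈? S)
∣p∣≡∑𝟙∈ [] = refl
∣p∣≡∑𝟙∈ (inside ∷ S) = cong suc (∣p∣≡∑𝟙∈ S)
∣p∣≡∑𝟙∈ (outside ∷ S) = ∣p∣≡∑𝟙∈ S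

∣p∪q∣≤∣p∣+∣q∣ : ∀ {n} (S T : Subset n) → ∣ S ∪ T ∣ ≤ ∣ S ∣ + ∣ T ∣
∣p∪q∣≤∣p∣+∣q∣ [] [] = z≤n
∣p∪q∣≤∣p∣+∣q∣ (inside ∷ S) (inside ∷ T) =
  s≤s (≤-trans (∣p∪q∣≤∣p∣+∣q∣ S T) (+-monoʳ-≤ ∣ S ∣ (n≤1+n _)))
∣p∪q∣≤∣p∣+∣q∣ (inside ∷ S) (outside ∷ T) = s≤s (∣p∪q∣≤∣p∣+∣q∣ S T)
∣p∪q∣≤∣p∣+∣q∣ (outside ∷ S) (inside ∷ T) =
  ≤-trans (s≤s (∣p∪q∣≤∣p∣+∣q∣ S T)) (≤-reflexive (sym (+-suc _ _)))
∣p∪q∣≤∣p∣+∣q∣ (outside ∷ S) (outside ∷ T) = ∣p∪q∣≤∣p∣+∣q∣ S T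

bounded∃? : ∀ {P : ℕ → Set ℓ} → (∀ k → Dec (P k)) → ∀ m → Dec (∃[ k ] (k ≤ m × P k))
bounded∃? {P = P} P? m = map′ fromFin toFin (any? (P? ∘ toℕ))
  where
  fromFin : ∃[ i ] P (toℕ {suc m} i) → ∃[ k ] (k ≤ m × P k)
  fromFin (i , Pi) = toℕ i , ≤-pred (toℕ<n i) , Pi
  toFin : ∃[ k ] (k ≤ m × P k) → ∃[ i ] P (toℕ {suc m} i)
  toFin (k , k≤m , Pk) = fromℕ< (s≤s k≤m) , subst P (sym (toℕ-fromℕ< (s≤s k≤m))) Pk

least : ∀ {P : ℕ → Set ℓ} → (∀ k → Dec (P k)) →
        ∀ {m} → P m → ∃[ k ] (P k × (∀ {k′} → P k′ → k ≤ k′))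
least {P = P} P? {m} Pm with scan (suc m)
  where
  scan : ∀ m → ∃[ k ] (P k × (∀ {k′} → P k′ → k ≤ k′)) ⊎ (∀ {k′} → k′ < m → ¬ P k′)
  scan zero = inj₂ λ ()
  scan (suc m) with scan m
  ... | inj₁ found = inj₁ found
  ... | inj₂ none with P? m
  ...   | yes Pm = inj₁ (m , Pm , λ Pk′ → ≮⇒≥ (λ k′<m → none k′<m Pk′))
  ...   | no ¬Pm = inj₂ below
    where
    below : ∀ {k′} → k′ < suc m → ¬ P k′
    below k′<1+m with m<1+n⇒m<n∨m≡n k′<1+m
    ... | inj₁ k′<m = none k′<m
    ... | inj₂ refl = ¬Pm
... | inj₁ found = found
... | inj₂ none = ⊥-elim (none ≤-refl Pm)

module Walks {n} (G : Graph n) where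

  Reach-mono : ∀ {d d′ u v} → d ≤ d′ → Reach G d u v → Reach G d′ u v
  Reach-mono = go ∘ ≤⇒≤′
    where
    go : ∀ {d d′ u v} → d ≤′ d′ → Reach G d u v → Reach G d′ u v
    go ≤′-refl w = w
    go (≤′-step d≤′d′) w = inj₁ (go d≤′d′ w)

  Reach-++ : ∀ a b {u w v} → Reach G a u w → Reach G b w v → Reach G (a + b) u v
  Reach-++ a zero uw refl = Reach-mono (m≤m+n a 0) uw
  Reach-++ a (suc b) uw wv rewrite +-suc a b with wv
  ... | inj₁ wv′ = inj₁ (Reach-++ a b uw wv′)
  ... | inj₂ (x , wx , x~v) = inj₂ (x , Reach-++ a b uw wx , x~v)

  Reach⇒≤ : (D : Fin n → Fin n → ℕ) → (∀ u → D u u ≡ 0) → (∀ u {w v} → G w v → D u v ≤ suc (D u w)) →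
            ∀ {d u v} → Reach G d u v → D u v ≤ d
  Reach⇒≤ D D-refl D-step {zero} {u} refl = ≤-reflexive (D-refl u)
  Reach⇒≤ D D-refl D-step {suc d} (inj₁ uv) = m≤n⇒m≤1+n (Reach⇒≤ D D-refl D-step uv)
  Reach⇒≤ D D-refl D-step {suc d} {u} (inj₂ (w , uw , w~v)) =
    ≤-trans (D-step u w~v) (s≤s (Reach⇒≤ D D-refl D-step uw))

  module _ (symmetric : ∀ {u v} → G u v → G v u) where

    Reach-sym : ∀ d {u v} → Reach G d u v → Reach G d v u
    Reach-sym zero refl = refl
    Reach-sym (suc d) (inj₁ uv) = inj₁ (Reach-sym d uv)
    Reach-sym (suc d) {v = v} (inj₂ (w , uw , w~v)) =
      Reach-++ 1 d (inj₂ (v , refl , symmetric w~v)) (Reach-sym d uw)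

    module _ (successor : ∀ {u v} → toℕ v ≡ suc (toℕ u) → G u v) where

      Reach-forward : ∀ k {u v} → toℕ v ≡ toℕ u + k → Reach G k u v
      Reach-forward zero v≡u+0 = sym (toℕ-injective (trans v≡u+0 (+-identityʳ _)))
      Reach-forward (suc k) {u} {v} v≡u+1+k =
        inj₂ (w , Reach-forward k (toℕ-fromℕ< u+k<n) ,
                  successor (trans v≡u+1+k (trans (+-suc _ _) (cong suc (sym (toℕ-fromℕ< u+k<n))))))
        where
        u+k<n : toℕ u + k < n
        u+k<n = ≤-trans (≤-reflexive (trans (sym (+-suc _ _)) (sym v≡u+1+k))) (<⇒≤ (toℕ<n v))
        w : Fin n
        w = fromℕ< u+k<n

      Reach-∣u-v∣ : ∀ u v → Reach G ∣ toℕ u - toℕ v ∣ u v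
      Reach-∣u-v∣ u v with ≤-total (toℕ u) (toℕ v)
      ... | inj₁ u≤v = subst (λ d → Reach G d u v) (sym (m≤n⇒∣m-n∣≡n∸m u≤v))
                         (Reach-forward _ (sym (m+[n∸m]≡n u≤v)))
      ... | inj₂ v≤u =
        subst (λ d → Reach G d u v) (trans (sym (m≤n⇒∣m-n∣≡n∸m v≤u)) (∣-∣-comm (toℕ v) (toℕ u)))
              (Reach-sym _ (Reach-forward _ (sym (m+[n∸m]≡n v≤u))))

module ExactDistance {n} (G : Graph n) (D : Fin n → Fin n → ℕ)
  (D≤ : ∀ {d u v} → Reach G d u v → D u v ≤ d)
  (Reach-D : ∀ u v → Reach G (D u v) u v) where

  TDist⇒≤D : ∀ {r u v d} → TDist G r u v d → d ≤ D u v
  TDist⇒≤D {u = u} {v} (_ , _ , minimal) = ≮⇒≥ (λ D<d → minimal _ D<d (Reach-D u v))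

  TDist⇒≡ : ∀ {r u v d} → TDist G r u v d → d ≡ D u v ⊓ suc r
  TDist⇒≡ {r} {u} {v} {d} dist@(d≤1+r , reach , _) with d ≤? r
  ... | yes d≤r = trans (sym D≡d) (sym (m≤n⇒m⊓n≡m (≤-trans (≤-reflexive D≡d) (m≤n⇒m≤1+n d≤r))))
    where
    D≡d : D u v ≡ d
    D≡d = ≤-antisym (D≤ (reach d≤r)) (TDist⇒≤D dist)
  ... | no d≰r = trans d≡1+r (sym (m≥n⇒m⊓n≡n (subst (_≤ D u v) d≡1+r (TDist⇒≤D dist))))
    where
    d≡1+r : d ≡ suc r
    d≡1+r = ≤-antisym d≤1+r (≰⇒> d≰r)

  TDist-D : ∀ r u v → TDist G r u v (D u v ⊓ suc r)
  TDist-D r u v = m⊓n≤n _ _ , reach , minimal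
    where
    reach : D u v ⊓ suc r ≤ r → Reach G (D u v ⊓ suc r) u v
    reach D⊓1+r≤r with ⊓-sel (D u v) (suc r)
    ... | inj₁ ≡D rewrite ≡D = Reach-D u v
    ... | inj₂ ≡1+r rewrite ≡1+r = ⊥-elim (1+n≰n D⊓1+r≤r)
    minimal : ∀ d → d < D u v ⊓ suc r → ¬ Reach G d u v
    minimal d d< reach-d = <⇒≱ (<-≤-trans d< (m⊓n≤m _ _)) (D≤ reach-d)

  edgeDist : ℕ → Edge G → Fin n → ℕ
  edgeDist r e v = (D v (lo e) ⊓ suc r) ⊓ (D v (hi e) ⊓ suc r)

  EDist⇒≡ : ∀ {r e v d} → EDist G r e v d → d ≡ edgeDist r e v
  EDist⇒≡ (_ , _ , lo-dist , hi-dist , d≡) = trans d≡ (cong₂ _⊓_ (TDist⇒≡ lo-dist) (TDist⇒≡ hi-dist))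

  EDist-edgeDist : ∀ r e v → EDist G r e v (edgeDist r e v)
  EDist-edgeDist r e v = _ , _ , TDist-D r v (lo e) , TDist-D r v (hi e) , refl

  Resolves : ℕ → Subset n → Set
  Resolves r S = ∀ e f → DistinctEdges e f → ∃[ v ] (v ∈ S × edgeDist r e v ≢ edgeDist r f v)

  EdgeResolving⇒Resolves : ∀ {r S} → EdgeResolving G r S → Resolves r S
  EdgeResolving⇒Resolves {r} resolving e f e≢f with resolving e f e≢f
  ... | v , v∈S , _ , _ , e-dist , f-dist , dists≢ =
    v , v∈S , λ dists≡ →
      dists≢ (trans (EDist⇒≡ {r} {e} e-dist) (trans dists≡ (sym (EDist⇒≡ {r} {f} f-dist))))

  Resolves⇒EdgeResolving : ∀ {r S} → Resolves r S → EdgeResolving G r S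
  Resolves⇒EdgeResolving {r} resolves e f e≢f with resolves e f e≢f
  ... | v , v∈S , dists≢ = v , v∈S , _ , _ , EDist-edgeDist r e v , EDist-edgeDist r f v , dists≢

  module _ (G? : ∀ u v → Dec (G u v)) where

    private
      ResolvesPair : ℕ → Subset n → (a b a′ b′ : Fin n) → Set
      ResolvesPair r S a b a′ b′ =
        (a Fin.< b × G a b × a′ Fin.< b′ × G a′ b′ × ¬ (a ≡ a′ × b ≡ b′)) →
        ∃[ v ] (v ∈ S × (D v a ⊓ suc r) ⊓ (D v b ⊓ suc r) ≢ (D v a′ ⊓ suc r) ⊓ (D v b′ ⊓ suc r))

    Resolves? : ∀ r S → Dec (Resolves r S)
    Resolves? r S =
      map′ curried uncurried (all? λ a → all? λ b → all? λ a′ → all? λ b′ → pair? a b a′ b′)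
      where
      pair? : ∀ a b a′ b′ → Dec (ResolvesPair r S a b a′ b′)
      pair? a b a′ b′ =
        (a Finₚ.<? b ×-dec G? a b ×-dec a′ Finₚ.<? b′ ×-dec G? a′ b′ ×-dec ¬? (a ≟ᶠ a′ ×-dec b ≟ᶠ b′))
          →-dec any? (λ v → v ∈? S ×-dec ¬? (_ ≟ _))
      curried : (∀ a b a′ b′ → ResolvesPair r S a b a′ b′) → Resolves r S
      curried h (edge a b a<b a~b) (edge a′ b′ a′<b′ a′~b′) distinct =
        h a b a′ b′ (a<b , a~b , a′<b′ , a′~b′ , distinct)
      uncurried : Resolves r S → ∀ a b a′ b′ → ResolvesPair r S a b a′ b′
      uncurried h a b a′ b′ (a<b , a~b , a′<b′ , a′~b′ , distinct) =
        h (edge a b a<b a~b) (edge a′ b′ a′<b′ a′~b′) distinct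

    -- The bound r ≤ t makes Achievable decidable and loses nothing, as r ≤ r + ∣ S ∣.
    Achievable : ℕ → Set
    Achievable t = ∃[ r ] (r ≤ t × ∃[ S ] (EdgeResolving G r S × r + ∣ S ∣ ≡ t))

    Achievable? : ∀ t → Dec (Achievable t)
    Achievable? t = bounded∃? (λ r → anySubset? (λ S → resolving? r S ×-dec (r + ∣ S ∣ ≟ t))) t
      where
      resolving? : ∀ r S → Dec (EdgeResolving G r S)
      resolving? r S = map′ Resolves⇒EdgeResolving EdgeResolving⇒Resolves (Resolves? r S)

    resolving⇒achievable : ∀ {r S} → EdgeResolving G r S → Achievable (r + ∣ S ∣)
    resolving⇒achievable {r} {S} resolving = r , m≤m+n _ _ , S , resolving , refl

    thEdim-exists : ∀ {r₀ S₀} → EdgeResolving G r₀ S₀ → ∃[ t ] (IsThEdim G t × t ≤ r₀ + ∣ S₀ ∣)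
    thEdim-exists resolving₀ with least Achievable? (resolving⇒achievable resolving₀)
    ... | t , (r , _ , S , resolving , r+∣S∣≡t) , t-least =
      t , ((r , ∣ S ∣ , isEdim , sym r+∣S∣≡t) , lower) , t-least (resolving⇒achievable resolving₀)
      where
      isEdim : IsEdim G r ∣ S ∣
      isEdim = (S , resolving , refl) , λ S′ resolving′ →
        +-cancelˡ-≤ r _ _ (subst (_≤ r + ∣ S′ ∣) (sym r+∣S∣≡t) (t-least (resolving⇒achievable resolving′)))
      lower : ∀ r′ k → IsEdim G r′ k → t ≤ r′ + k
      lower r′ k ((S′ , resolving′ , ∣S′∣≡k) , _) =
        subst (t ≤_) (cong (r′ +_) ∣S′∣≡k) (t-least (resolving⇒achievable resolving′))

-- The counting lower bound

-- δ i v is the distance from landmark v to item i truncated at L; the value L means v does not see i.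
module CountingBound {m n L : ℕ} (S : Subset n) (δ : Fin m → Fin n → ℕ)
  (δ≤L : ∀ i v → δ i v ≤ L)
  (separated : ∀ {i j} → i ≢ j → ∃[ v ] (v ∈ S × δ i v ≢ δ j v))
  (≤2-at : ∀ v d → d < L → ∑[ i < m ] 𝟙 (δ i v ≟ d) ≤ 2) where

  sees : Fin n → Fin m → ℕ
  sees v i = 𝟙 (v ∈? S ×-dec δ i v <? L)

  watchers : Fin m → ℕ
  watchers i = ∑[ v < n ] sees v i

  unseen⇒δ≡L : ∀ {i v} → v ∈ S → sees v i ≡ 0 → δ i v ≡ L
  unseen⇒δ≡L {i} {v} v∈S unseen =
    ≤-antisym (δ≤L i v) (≮⇒≥ λ δ<L → 1+n≢0 (trans (sym (𝟙-yes (v ∈? S ×-dec δ i v <? L) (v∈S , δ<L))) unseen))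

  seen≤2L : ∀ v → ∑[ i < m ] 𝟙 (δ i v <? L) ≤ L * 2
  seen≤2L v = begin
      ∑[ i < m ] 𝟙 (δ i v <? L)                 ≤⟨ ∑-mono-≤ at-some-distance ⟩
      ∑[ i < m ] ∑[ d < L ] 𝟙 (δ i v ≟ toℕ d)   ≡⟨ ∑-comm {m} {L} (λ i d → 𝟙 (δ i v ≟ toℕ d)) ⟩
      ∑[ d < L ] ∑[ i < m ] 𝟙 (δ i v ≟ toℕ d)   ≤⟨ ∑-mono-≤ (λ d → ≤2-at v (toℕ d) (toℕ<n d)) ⟩
      ∑[ d < L ] 2                               ≡⟨ ∑-const L 2 ⟩
      L * 2                                      ∎
    where
    open ≤-Reasoning
    at-some-distance : ∀ i → 𝟙 (δ i v <? L) ≤ ∑[ d < L ] 𝟙 (δ i v ≟ toℕ d)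
    at-some-distance i = 𝟙≤ (δ i v <? L) λ δ<L →
      ≤-trans (≤-reflexive (sym (𝟙-yes (δ i v ≟ toℕ (fromℕ< δ<L)) (sym (toℕ-fromℕ< δ<L)))))
              (f[i]≤∑f (λ d → 𝟙 (δ i v ≟ toℕ d)) (fromℕ< δ<L))

  ∑watchers≤2L∣S∣ : ∑[ i < m ] watchers i ≤ L * 2 * ∣ S ∣
  ∑watchers≤2L∣S∣ = begin
      ∑[ i < m ] ∑[ v < n ] sees v i       ≡⟨ ∑-comm (λ i v → sees v i) ⟩
      ∑[ v < n ] ∑[ i < m ] sees v i       ≤⟨ ∑-mono-≤ per-landmark ⟩
      ∑[ v < n ] (L * 2 * 𝟙 (v ∈? S))      ≡⟨ *-distribˡ-sum (L * 2) (λ v → 𝟙 (v ∈? S)) ⟨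
      L * 2 * ∑[ v < n ] 𝟙 (v ∈? S)        ≡⟨ cong (L * 2 *_) (∣p∣≡∑𝟙∈ S) ⟨
      L * 2 * ∣ S ∣                        ∎
    where
    open ≤-Reasoning
    per-landmark : ∀ v → ∑[ i < m ] sees v i ≤ L * 2 * 𝟙 (v ∈? S)
    per-landmark v = by-membership (v ∈? S)
      where
      by-membership : (v∈?S : Dec (v ∈ S)) → ∑[ i < m ] 𝟙 (v∈?S ×-dec δ i v <? L) ≤ L * 2 * 𝟙 v∈?S
      by-membership (yes _) = ≤-trans (seen≤2L v) (≤-reflexive (sym (*-identityʳ _)))
      by-membership (no _) = ≤-reflexive (trans (∑-zero {m} (λ _ → refl)) (sym (*-zeroʳ (L * 2))))

  unwatched⇒δ≡L : ∀ {i v} → v ∈ S → watchers i ≡ 0 → δ i v ≡ L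
  unwatched⇒δ≡L {i} {v} v∈S unwatched =
    unseen⇒δ≡L v∈S (n≤0⇒n≡0 (≤-trans (f[i]≤∑f (λ v → sees v i) v) (≤-reflexive unwatched)))

  ∑unwatched≤1 : ∑[ i < m ] 𝟙 (watchers i ≟ 0) ≤ 1
  ∑unwatched≤1 = ∑𝟙≤1 (λ i → watchers i ≟ 0) unique
    where
    unique : ∀ {i j} → watchers i ≡ 0 → watchers j ≡ 0 → i ≡ j
    unique {i} {j} i-unwatched j-unwatched with i ≟ᶠ j
    ... | yes i≡j = i≡j
    ... | no i≢j with separated i≢j
    ...   | v , v∈S , δ≢ =
      ⊥-elim (δ≢ (trans (unwatched⇒δ≡L v∈S i-unwatched) (sym (unwatched⇒δ≡L v∈S j-unwatched))))

  onlyWatcher : ∀ {i v w} → watchers i ≡ 1 → v ∈ S → δ i v < L → w ≢ v → sees w i ≡ 0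
  onlyWatcher {i} {v} {w} once v∈S δ<L w≢v = n≤0⇒n≡0 (+-cancelʳ-≤ 1 _ 0 (begin
    sees w i + 1         ≡⟨ cong (sees w i +_) (𝟙-yes (v ∈? S ×-dec δ i v <? L) (v∈S , δ<L)) ⟨
    sees w i + sees v i  ≤⟨ f[i]+f[j]≤∑f (λ u → sees u i) w≢v ⟩
    watchers i           ≡⟨ once ⟩
    1                    ∎))
    where open ≤-Reasoning

  WatchedOnceBy : Fin m → Fin n → Fin L → Set
  WatchedOnceBy i v d = watchers i ≡ 1 × v ∈ S × δ i v ≡ toℕ d

  WatchedOnceBy? : ∀ i v d → Dec (WatchedOnceBy i v d)
  WatchedOnceBy? i v d = watchers i ≟ 1 ×-dec v ∈? S ×-dec δ i v ≟ toℕ d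

  WatchedOnceBy-unique : ∀ {v d i j} → WatchedOnceBy i v d → WatchedOnceBy j v d → i ≡ j
  WatchedOnceBy-unique {v} {d} {i} {j} (i-once , v∈S , δi≡d) (j-once , _ , δj≡d) with i ≟ᶠ j
  ... | yes i≡j = i≡j
  ... | no i≢j with separated i≢j
  ...   | w , w∈S , δ≢ with w ≟ᶠ v
  ...     | yes refl = ⊥-elim (δ≢ (trans δi≡d (sym δj≡d)))
  ...     | no w≢v = ⊥-elim (δ≢ (trans (δ≡L i-once δi≡d) (sym (δ≡L j-once δj≡d))))
    where
    δ≡L : ∀ {k} → watchers k ≡ 1 → δ k v ≡ toℕ d → δ k w ≡ L
    δ≡L once δ≡d = unseen⇒δ≡L w∈S (onlyWatcher once v∈S (subst (_< L) (sym δ≡d) (toℕ<n d)) w≢v)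

  ∑watchedOnce≤L∣S∣ : ∑[ i < m ] 𝟙 (watchers i ≟ 1) ≤ L * ∣ S ∣
  ∑watchedOnce≤L∣S∣ = begin
      ∑[ i < m ] 𝟙 (watchers i ≟ 1)                             ≤⟨ ∑-mono-≤ has-watcher ⟩
      ∑[ i < m ] ∑[ v < n ] ∑[ d < L ] 𝟙 (WatchedOnceBy? i v d)  ≡⟨ ∑-comm {m} {n} _ ⟩
      ∑[ v < n ] ∑[ i < m ] ∑[ d < L ] 𝟙 (WatchedOnceBy? i v d)  ≡⟨ sum-cong-≗ {n} (λ v → ∑-comm {m} {L} _) ⟩
      ∑[ v < n ] ∑[ d < L ] ∑[ i < m ] 𝟙 (WatchedOnceBy? i v d)  ≤⟨ ∑-mono-≤ (λ v → ∑-mono-≤ (λ d → ≤𝟙∈ v d)) ⟩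
      ∑[ v < n ] ∑[ d < L ] 𝟙 (v ∈? S)                          ≡⟨ sum-cong-≗ {n} (λ v → ∑-const L _) ⟩
      ∑[ v < n ] (L * 𝟙 (v ∈? S))                               ≡⟨ *-distribˡ-sum L (λ v → 𝟙 (v ∈? S)) ⟨
      L * ∑[ v < n ] 𝟙 (v ∈? S)                                 ≡⟨ cong (L *_) (∣p∣≡∑𝟙∈ S) ⟨
      L * ∣ S ∣                                                 ∎
    where
    open ≤-Reasoning
    has-watcher : ∀ i → 𝟙 (watchers i ≟ 1) ≤ ∑[ v < n ] ∑[ d < L ] 𝟙 (WatchedOnceBy? i v d)
    has-watcher i = 𝟙≤ (watchers i ≟ 1) λ once → witness once (∑-pos (λ v → sees v i) (≤-reflexive (sym once)))
      where
      witness : watchers i ≡ 1 → ∃[ v ] 1 ≤ sees v i → 1 ≤ ∑[ v < n ] ∑[ d < L ] 𝟙 (WatchedOnceBy? i v d)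
      witness once (v , seen) with 𝟙-pos (v ∈? S ×-dec δ i v <? L) seen
      ... | v∈S , δ<L =
        ≤-trans (≤-reflexive (sym (𝟙-yes (WatchedOnceBy? i v (fromℕ< δ<L)) (once , v∈S , sym (toℕ-fromℕ< δ<L)))))
                (≤-trans (f[i]≤∑f (λ d → 𝟙 (WatchedOnceBy? i v d)) (fromℕ< δ<L))
                         (f[i]≤∑f (λ v → ∑[ d < L ] 𝟙 (WatchedOnceBy? i v d)) v))
    ≤𝟙∈ : ∀ v d → ∑[ i < m ] 𝟙 (WatchedOnceBy? i v d) ≤ 𝟙 (v ∈? S)
    ≤𝟙∈ v d = by-membership (v ∈? S)
      where
      by-membership : (v∈?S : Dec (v ∈ S)) →
                      ∑[ i < m ] 𝟙 (watchers i ≟ 1 ×-dec v∈?S ×-dec δ i v ≟ toℕ d) ≤ 𝟙 v∈?S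
      by-membership v∈?S@(yes _) =
        ∑𝟙≤1 (λ i → watchers i ≟ 1 ×-dec v∈?S ×-dec δ i v ≟ toℕ d) WatchedOnceBy-unique
      by-membership v∈?S@(no v∉S) = ≤-reflexive (∑-zero {m} λ i →
        𝟙-no (watchers i ≟ 1 ×-dec v∈?S ×-dec δ i v ≟ toℕ d) (v∉S ∘ proj₁ ∘ proj₂))

  2m≤3L∣S∣+2 : 2 * m ≤ 3 * L * ∣ S ∣ + 2
  2m≤3L∣S∣+2 = begin
      2 * m                                            ≡⟨ *-comm 2 m ⟩
      m * 2                                            ≡⟨ ∑-const m 2 ⟨
      ∑[ i < m ] 2                                     ≤⟨ ∑-mono-≤ (λ i → 2≤ (watchers i)) ⟩
      ∑[ i < m ] (2 * [0] i + [1] i + watchers i)      ≡⟨ ∑-distrib-+ (λ i → 2 * [0] i + [1] i) watchers ⟩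
      ∑[ i < m ] (2 * [0] i + [1] i) + sum watchers    ≡⟨ cong (_+ sum watchers) (∑-distrib-+ (λ i → 2 * [0] i) [1]) ⟩
      ∑[ i < m ] (2 * [0] i) + sum [1] + sum watchers
        ≡⟨ cong (λ x → x + sum [1] + sum watchers) (*-distribˡ-sum 2 [0]) ⟨
      2 * sum [0] + sum [1] + sum watchers
        ≤⟨ +-mono-≤ (+-mono-≤ (*-monoʳ-≤ 2 ∑unwatched≤1) ∑watchedOnce≤L∣S∣) ∑watchers≤2L∣S∣ ⟩
      2 * 1 + L * ∣ S ∣ + L * 2 * ∣ S ∣                ≡⟨ arithmetic L ∣ S ∣ ⟩
      3 * L * ∣ S ∣ + 2                                ∎
    where
    open ≤-Reasoning
    [0] [1] : Fin m → ℕ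
    [0] i = 𝟙 (watchers i ≟ 0)
    [1] i = 𝟙 (watchers i ≟ 1)
    2≤ : ∀ c → 2 ≤ 2 * 𝟙 (c ≟ 0) + 𝟙 (c ≟ 1) + c
    2≤ 0 = ≤-refl
    2≤ 1 = ≤-refl
    2≤ c@(suc (suc c′)) = ≤-trans (m≤m+n 2 c′) (m≤n+m c (2 * 𝟙 (c ≟ 0) + 𝟙 (c ≟ 1)))
    arithmetic : ∀ L s → 2 * 1 + L * s + L * 2 * s ≡ 3 * L * s + 2
    arithmetic = solve-∀

-- Distances to the edges of the line

-- The distance from the vertex p of the line ℕ to its edge {i, i + 1}.
lineDist : ℕ → ℕ → ℕ
lineDist i p = ∣ p - i ∣ ⊓ ∣ p - suc i ∣

lineDist-above : ∀ p d → lineDist (p + d) p ≡ d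
lineDist-above p d
  rewrite ∣m-m+n∣≡n p d | sym (+-suc p d) | ∣m-m+n∣≡n p (suc d) = m≤n⇒m⊓n≡m (n≤1+n d)

lineDist-below : ∀ i d → lineDist i (i + 1 + d) ≡ d
lineDist-below i d
  rewrite +-assoc i 1 d | ∣-∣-comm (i + suc d) i | ∣m-m+n∣≡n i (suc d) | ∣-∣-comm (i + suc d) (suc i)
        | +-suc i d | ∣m-m+n∣≡n (suc i) d = m≥n⇒m⊓n≡n (n≤1+n d)

lineDist-≡ : ∀ {i p d} → i ≡ p + d ⊎ i + 1 + d ≡ p → lineDist i p ≡ d
lineDist-≡ {p = p} {d} (inj₁ refl) = lineDist-above p d
lineDist-≡ {i} (inj₂ refl) = lineDist-below i _

lineDist-cases : ∀ i p → (∃[ d ] i ≡ p + d) ⊎ (∃[ d ] i + 1 + d ≡ p)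
lineDist-cases i p with ≤-total p i
... | inj₁ p≤i = inj₁ (i ∸ p , sym (m+[n∸m]≡n p≤i))
... | inj₂ i≤p with m≤n⇒m<n∨m≡n i≤p
...   | inj₁ i<p = inj₂ (p ∸ suc i , trans (cong (_+ (p ∸ suc i)) (+-comm i 1)) (m+[n∸m]≡n i<p))
...   | inj₂ refl = inj₁ (0 , sym (+-identityʳ i))

lineDist≡⇒ : ∀ {i p d} → lineDist i p ≡ d → i ≡ p + d ⊎ i + 1 + d ≡ p
lineDist≡⇒ {i} {p} refl with lineDist-cases i p
... | inj₁ (d , refl) = inj₁ (cong (p +_) (sym (lineDist-above p d)))
... | inj₂ (d , refl) = inj₂ (cong (i + 1 +_) (lineDist-below i d))

k≤∣n-m∣ : ∀ {m n k} → m + k ≤ n → k ≤ ∣ n - m ∣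
k≤∣n-m∣ {m} {n} {k} m+k≤n = ≤-trans (m+n≤o⇒m≤o∸n k (subst (_≤ n) (+-comm m k) m+k≤n)) (m∸n≤∣m-n∣ n m)

lineDist-≥-left : ∀ {i p L} → suc i + L ≤ p → L ≤ lineDist i p
lineDist-≥-left {i} {p} {L} i+1+L≤p =
  ⊓-glb (k≤∣n-m∣ (≤-trans (+-monoˡ-≤ L (n≤1+n i)) i+1+L≤p)) (k≤∣n-m∣ i+1+L≤p)

lineDist-≥-right : ∀ {i p L} → p + L ≤ i → L ≤ lineDist i p
lineDist-≥-right {i} {p} p+L≤i =
  ⊓-glb (subst (_ ≤_) (∣-∣-comm i p) (k≤∣n-m∣ p+L≤i))
        (subst (_ ≤_) (∣-∣-comm (suc i) p) (k≤∣n-m∣ (m≤n⇒m≤1+n p+L≤i)))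

lineDist-< : ∀ {i p L} → p ≤ i + L → i < p + L → lineDist i p < L
lineDist-< {i} {p} {L} p≤i+L i<p+L with lineDist-cases i p
... | inj₁ (d , refl) = subst (_< L) (sym (lineDist-above p d)) (+-cancelˡ-< p d L i<p+L)
... | inj₂ (d , refl) = subst (_< L) (sym (lineDist-below i d))
                          (+-cancelˡ-≤ i (suc d) L (subst (_≤ i + L) (+-assoc i 1 d) p≤i+L))

⊓-≡-below : ∀ {x y L} → x ⊓ L ≡ y → y < L → x ≡ y
⊓-≡-below {x} {y} {L} x⊓L≡y y<L with x <? L
... | yes x<L = trans (sym (m≤n⇒m⊓n≡m (<⇒≤ x<L))) x⊓L≡y
... | no x≮L = ⊥-elim (<⇒≢ y<L (trans (sym x⊓L≡y) (m≥n⇒m⊓n≡n (≮⇒≥ x≮L))))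

⊓-separates : ∀ {x y L} → x < L → L ≤ y → x ⊓ L ≢ y ⊓ L
⊓-separates x<L L≤y x⊓L≡y⊓L =
  <⇒≢ x<L (trans (sym (m≤n⇒m⊓n≡m (<⇒≤ x<L))) (trans x⊓L≡y⊓L (m≥n⇒m⊓n≡n L≤y)))

-- A landmark p sees the edges p + d and p - 1 - d at the same distance d < L; a second landmark at
-- distance L from p sees exactly one of them.
straddle-right : ∀ {p L d x y} → d < L → x ≡ p + d → y + 1 + d ≡ p →
                 lineDist x (p + L) ⊓ L ≢ lineDist y (p + L) ⊓ L
straddle-right {p} {d = d} {y = y} d<L refl refl with m≤n⇒∃[o]m+o≡n d<L
... | e , refl =
  subst₂ (λ a b → a ⊓ L ≢ b ⊓ L) (sym x-far) (sym y-far) (⊓-separates (m<n+m e z<s) (m≤n+m L d))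
  where
  L = suc d + e
  x-far : lineDist (y + 1 + d + d) (y + 1 + d + L) ≡ e
  x-far = lineDist-≡ (inj₂ (arithmetic (y + 1 + d) d e))
    where
    arithmetic : ∀ p d e → p + d + 1 + e ≡ p + (suc d + e)
    arithmetic = solve-∀
  y-far : lineDist y (y + 1 + d + L) ≡ d + L
  y-far = lineDist-≡ (inj₂ (sym (+-assoc (y + 1) d L)))

straddle-left : ∀ {p L d x y} → d < L → x ≡ p + L + d → y + 1 + d ≡ p + L →
                lineDist x p ⊓ L ≢ lineDist y p ⊓ L
straddle-left {p} {d = d} {y = y} d<L refl y+1+d≡p+L with m≤n⇒∃[o]m+o≡n d<L
... | e , refl = subst₂ (λ a b → a ⊓ L ≢ b ⊓ L) (sym x-far) (sym y-near)
                   (≢-sym (⊓-separates (m<n+m e z<s) (m≤m+n L d)))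
  where
  L = suc d + e
  x-far : lineDist (p + L + d) p ≡ L + d
  x-far = lineDist-≡ (inj₁ (+-assoc p L d))
  y-near : lineDist y p ≡ e
  y-near = lineDist-≡ (inj₁ (+-cancelʳ-≡ (1 + d) y (p + e) (begin
    y + (1 + d)      ≡⟨ +-assoc y 1 d ⟨
    y + 1 + d        ≡⟨ y+1+d≡p+L ⟩
    p + L            ≡⟨ arithmetic p d e ⟩
    p + e + (1 + d)  ∎)))
    where
    open ≡-Reasoning
    arithmetic : ∀ p d e → p + (suc d + e) ≡ p + e + (1 + d)
    arithmetic = solve-∀

+1+d-cancel : ∀ {i j d} → j + 1 + d ≡ i + 1 + d → j ≡ i
+1+d-cancel {i} {j} {d} eq = +-cancelʳ-≡ 1 j i (+-cancelʳ-≡ d (j + 1) (i + 1) eq)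

lineDist-pair-injective : ∀ {p L i j} → lineDist i p < L ⊎ lineDist i (p + L) < L →
  lineDist j p ⊓ L ≡ lineDist i p ⊓ L → lineDist j (p + L) ⊓ L ≡ lineDist i (p + L) ⊓ L → j ≡ i
lineDist-pair-injective {p} {L} {i} {j} (inj₁ seen) at-p at-p+L
  with lineDist≡⇒ {i} {p} refl
     | lineDist≡⇒ {j} {p} (⊓-≡-below (trans at-p (m≤n⇒m⊓n≡m (<⇒≤ seen))) seen)
... | inj₁ i≡ | inj₁ j≡ = trans j≡ (sym i≡)
... | inj₂ i≡ | inj₂ j≡ = +1+d-cancel (trans j≡ (sym i≡))
... | inj₁ i≡ | inj₂ j≡ = ⊥-elim (straddle-right seen i≡ j≡ (sym at-p+L))
... | inj₂ i≡ | inj₁ j≡ = ⊥-elim (straddle-right seen j≡ i≡ at-p+L)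
lineDist-pair-injective {p} {L} {i} {j} (inj₂ seen) at-p at-p+L
  with lineDist≡⇒ {i} {p + L} refl
     | lineDist≡⇒ {j} {p + L} (⊓-≡-below (trans at-p+L (m≤n⇒m⊓n≡m (<⇒≤ seen))) seen)
... | inj₁ i≡ | inj₁ j≡ = trans j≡ (sym i≡)
... | inj₂ i≡ | inj₂ j≡ = +1+d-cancel (trans j≡ (sym i≡))
... | inj₁ i≡ | inj₂ j≡ = ⊥-elim (straddle-left seen i≡ j≡ (sym at-p))
... | inj₂ i≡ | inj₁ j≡ = ⊥-elim (straddle-left seen j≡ i≡ at-p)

+L+L+L≡+3L : ∀ a L → a + L + L + L ≡ a + 3 * L
+L+L+L≡+3L = solve-∀

lineDist-block : ∀ {a L i} → a ≤ i → i < a + 3 * L → lineDist i (a + L) < L ⊎ lineDist i (a + L + L) < L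
lineDist-block {a} {L} {i} a≤i i<a+3L with i <? a + L + L
... | yes i<a+2L = inj₁ (lineDist-< (+-monoˡ-≤ L a≤i) i<a+2L)
... | no i≮a+2L = inj₂ (lineDist-< (+-monoˡ-≤ L (≤-trans (m≤m+n (a + L) L) (≮⇒≥ i≮a+2L)))
                                    (subst (i <_) (sym (+L+L+L≡+3L a L)) i<a+3L))

-- The ring solver does not read _^_, so squares in its identities are written x * (x * 1), which
-- is what x ^ 2 unfolds to.
4xy≤[x+y]² : ∀ x y → 4 * (x * y) ≤ (x + y) ^ 2
4xy≤[x+y]² x y with ≤-total x y
... | inj₁ x≤y with m≤n⇒∃[o]m+o≡n x≤y
...   | w , refl = ≤-trans (m≤m+n _ (w ^ 2)) (≤-reflexive (identity x w))
  where
  identity : ∀ x w → 4 * (x * (x + w)) + w * (w * 1) ≡ (x + (x + w)) * ((x + (x + w)) * 1)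
  identity = solve-∀
4xy≤[x+y]² x y | inj₂ y≤x with m≤n⇒∃[o]m+o≡n y≤x
...   | w , refl = ≤-trans (m≤m+n _ (w ^ 2)) (≤-reflexive (identity y w))
  where
  identity : ∀ y w → 4 * ((y + w) * y) + w * (w * 1) ≡ (y + w + y) * ((y + w + y) * 1)
  identity = solve-∀

sqrt-bracket : ∀ n → ∃[ h ] (6 * h ^ 2 ≤ n × n < 6 * suc h ^ 2)
sqrt-bracket zero = 0 , z≤n , s≤s z≤n
sqrt-bracket (suc n) with sqrt-bracket n
... | h , 6h²≤n , n<6[h+1]² with 6 * suc h ^ 2 ≤? suc n
...   | yes 6[h+1]²≤1+n = suc h , 6[h+1]²≤1+n , ≤-<-trans n<6[h+1]² (*-monoʳ-< 6 (^-monoˡ-< 2 (n<1+n (suc h))))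
...   | no 6[h+1]²≰1+n = h , m≤n⇒m≤1+n 6h²≤n , ≰⇒> 6[h+1]²≰1+n

threshold : ℕ → ℕ
threshold k = 6 * (3 + 2 * k) ^ 2

landmarkScale : ∀ k n → threshold k ≤ n → ∃[ w ] (6 * (2 + w) ^ 2 ≤ n × n < 6 * (3 + w) ^ 2 × 2 * k ≤ w)
landmarkScale k n large with sqrt-bracket n
... | h , 6h²≤n , n<6[h+1]² with 2 + 2 * k ≤? h
...   | no h<2+2k =
  ⊥-elim (<⇒≱ n<6[h+1]² (≤-trans (*-monoʳ-≤ 6 (^-monoˡ-≤ 2 (m≤n⇒m≤1+n (≰⇒> h<2+2k)))) large))
...   | yes 2+2k≤h with m≤n⇒∃[o]m+o≡n 2+2k≤h
...     | u , refl = 2 * k + u , 6h²≤n′ , n<6[h+1]²′ , m≤m+n (2 * k) u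
  where
  shift : 2 + 2 * k + u ≡ 2 + (2 * k + u)
  shift = +-assoc 2 (2 * k) u
  6h²≤n′ = subst (λ h → 6 * h ^ 2 ≤ n) shift 6h²≤n
  n<6[h+1]²′ = subst (λ h → n < 6 * suc h ^ 2) shift n<6[h+1]²

a²b²≡[ab]² : ∀ a b → a ^ 2 * b ^ 2 ≡ (a * b) ^ 2
a²b²≡[ab]² = identity
  where
  identity : ∀ a b → (a * (a * 1)) * (b * (b * 1)) ≡ (a * b) * ((a * b) * 1)
  identity = solve-∀

upperEstimate : ∀ {k n w t} → 2 * k ≤ w → 6 * (2 + w) ^ 2 ≤ n → t ≤ 4 * (2 + w) + 5 →
                3 * suc k ^ 2 * t ^ 2 ≤ 8 * suc (suc k) ^ 2 * n
upperEstimate {k} {n} {w} {t} 2k≤w 6h²≤n t≤4h+5 = begin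
    3 * suc k ^ 2 * t ^ 2                ≡⟨ *-assoc 3 (suc k ^ 2) (t ^ 2) ⟩
    3 * (suc k ^ 2 * t ^ 2)              ≡⟨ cong (3 *_) (a²b²≡[ab]² (suc k) t) ⟩
    3 * (suc k * t) ^ 2                  ≤⟨ *-monoʳ-≤ 3 (^-monoˡ-≤ 2 (*-monoʳ-≤ (suc k) t≤4h+5)) ⟩
    3 * (suc k * (4 * h + 5)) ^ 2        ≤⟨ *-monoʳ-≤ 3 (^-monoˡ-≤ 2 (linear 2k≤w)) ⟩
    3 * (suc (suc k) * (4 * h)) ^ 2      ≡⟨ square (suc (suc k)) h ⟩
    8 * suc (suc k) ^ 2 * (6 * h ^ 2)    ≤⟨ *-monoʳ-≤ (8 * suc (suc k) ^ 2) 6h²≤n ⟩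
    8 * suc (suc k) ^ 2 * n              ∎
  where
  open ≤-Reasoning
  h = 2 + w
  linear : ∀ {w} → 2 * k ≤ w → suc k * (4 * (2 + w) + 5) ≤ suc (suc k) * (4 * (2 + w))
  linear 2k≤w with m≤n⇒∃[o]m+o≡n 2k≤w
  ... | u , refl = ≤-trans (m≤m+n _ (3 + 3 * k + 4 * u)) (≤-reflexive (identity k u))
    where
    identity : ∀ k u → suc k * (4 * (2 + (2 * k + u)) + 5) + (3 + 3 * k + 4 * u)
                       ≡ suc (suc k) * (4 * (2 + (2 * k + u)))
    identity = solve-∀
  square : ∀ a h → 3 * (a * (4 * h)) ^ 2 ≡ 8 * a ^ 2 * (6 * h ^ 2)
  square = identity
    where
    identity : ∀ a h → 3 * ((a * (4 * h)) * ((a * (4 * h)) * 1)) ≡ 8 * (a * (a * 1)) * (6 * (h * (h * 1)))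
    identity = solve-∀

lowerEstimate : ∀ {k n m r s} → n ≤ suc m → 2 * m ≤ 3 * suc r * s + 2 → threshold k ≤ n →
                8 * k ^ 2 * n ≤ 3 * suc k ^ 2 * (r + s) ^ 2
lowerEstimate {k} {n} {m} {r} {s} n≤1+m 2m≤ large = begin
    8 * k ^ 2 * n                        ≡⟨ trans (cong (_* n) (*-comm 8 (k ^ 2))) (*-assoc (k ^ 2) 8 n) ⟩
    k ^ 2 * (8 * n)                      ≤⟨ *-monoʳ-≤ (k ^ 2) 8n≤ ⟩
    k ^ 2 * (3 * suc t ^ 2 + 16)         ≤⟨ polynomial 3k≤t ⟩
    3 * suc k ^ 2 * t ^ 2                ∎
  where
  open ≤-Reasoning
  t = r + s
  8n≤ : 8 * n ≤ 3 * suc t ^ 2 + 16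
  8n≤ = begin
    8 * n                          ≤⟨ *-monoʳ-≤ 8 n≤1+m ⟩
    8 * suc m                      ≡⟨ identity₁ m ⟩
    4 * (2 * m + 2)                ≤⟨ *-monoʳ-≤ 4 (+-monoˡ-≤ 2 2m≤) ⟩
    4 * (3 * suc r * s + 2 + 2)    ≡⟨ identity₂ (suc r) s ⟩
    3 * (4 * (suc r * s)) + 16     ≤⟨ +-monoˡ-≤ 16 (*-monoʳ-≤ 3 (4xy≤[x+y]² (suc r) s)) ⟩
    3 * suc t ^ 2 + 16             ∎
    where
    identity₁ : ∀ m → 8 * suc m ≡ 4 * (2 * m + 2)
    identity₁ = solve-∀
    identity₂ : ∀ l s → 4 * (3 * l * s + 2 + 2) ≡ 3 * (4 * (l * s)) + 16
    identity₂ = solve-∀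
  3k≤t : 3 * k ≤ t
  3k≤t = ≮⇒≥ λ t<3k → <⇒≱ (begin-strict
    3 * suc t ^ 2 + 16       ≤⟨ +-monoˡ-≤ 16 (*-monoʳ-≤ 3 (^-monoˡ-≤ 2 t<3k)) ⟩
    3 * (3 * k) ^ 2 + 16     <⟨ m<m+n _ z<s ⟩
    _                        ≡⟨ identity k ⟩
    8 * threshold k          ≤⟨ *-monoʳ-≤ 8 large ⟩
    8 * n                    ∎) 8n≤
    where
    identity : ∀ k → 3 * ((3 * k) * ((3 * k) * 1)) + 16 + suc (415 + 576 * k + 165 * (k * k))
                     ≡ 8 * (6 * ((3 + 2 * k) * ((3 + 2 * k) * 1)))
    identity = solve-∀
  polynomial : ∀ {t} → 3 * k ≤ t → k ^ 2 * (3 * suc t ^ 2 + 16) ≤ 3 * suc k ^ 2 * t ^ 2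
  polynomial 3k≤t with m≤n⇒∃[o]m+o≡n 3k≤t
  ... | u , refl = ≤-trans (m≤m+n _ _) (≤-reflexive (identity k u))
    where
    identity : ∀ k u → k * (k * 1) * (3 * (suc (3 * k + u) * (suc (3 * k + u) * 1)) + 16)
                       + (36 * (k * k * k) + 30 * (k * k * u) + 6 * (k * u * u) + 8 * (k * k) + 18 * (k * u) + 3 * (u * u))
                     ≡ 3 * (suc k * (suc k * 1)) * ((3 * k + u) * ((3 * k + u) * 1))
    identity = solve-∀

blocks-fit : ∀ {m n w} → m ≤ n → n ≤ suc m → 6 * (2 + w) ^ 2 ≤ n → n < 6 * (3 + w) ^ 2 →
             3 * (2 + w + (2 + w)) ≤ m × m ≤ (5 + w) * (3 * (2 + w + (2 + w)))
blocks-fit {m} {n} {w} m≤n n≤1+m 6h²≤n n<6[h+1]² =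
  ≤-pred (≤-trans (m≤m+n _ _) (≤-trans (≤-reflexive (identity₁ w)) (≤-trans 6h²≤n n≤1+m))) ,
  ≤-trans m≤n (≤-trans (<⇒≤ n<6[h+1]²) (≤-trans (m≤m+n _ (6 + 6 * w)) (≤-reflexive (identity₂ w))))
  where
  identity₁ : ∀ w → suc (3 * (2 + w + (2 + w))) + (6 * (w * w) + 18 * w + 11) ≡ 6 * ((2 + w) * ((2 + w) * 1))
  identity₁ = solve-∀
  identity₂ : ∀ w → 6 * ((3 + w) * ((3 + w) * 1)) + (6 + 6 * w) ≡ (5 + w) * (3 * (2 + w + (2 + w)))
  identity₂ = solve-∀

cost≤4h+5 : ∀ {w t s} → t ≤ 1 + w + (2 + w) + s → s ≤ 2 * (5 + w) → t ≤ 4 * (2 + w) + 5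
cost≤4h+5 {w} t≤ s≤ = ≤-trans t≤ (≤-trans (+-monoʳ-≤ (1 + w + (2 + w)) s≤) (≤-reflexive (identity w)))
  where
  identity : ∀ w → 1 + w + (2 + w) + 2 * (5 + w) ≡ 4 * (2 + w) + 5
  identity = solve-∀

-- Graphs with numbered edges

-- Modulo N, edge i starts d steps after vertex s (Ahead) or ends d steps before it (Behind).
Ahead : ℕ → ℕ → ℕ → ℕ → Set
Ahead N s d i = i ≡ s + d ⊎ i + N ≡ s + d

Behind : ℕ → ℕ → ℕ → ℕ → Set
Behind N s d i = i + 1 + d ≡ s ⊎ i + 1 + d ≡ s + N

Ahead-unique : ∀ {N s d i j} → i < N → j < N → Ahead N s d i → Ahead N s d j → i ≡ j
Ahead-unique i<N j<N (inj₁ i≡) (inj₁ j≡) = trans i≡ (sym j≡)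
Ahead-unique {N} {i = i} {j} i<N j<N (inj₂ i≡) (inj₂ j≡) = +-cancelʳ-≡ N i j (trans i≡ (sym j≡))
Ahead-unique {N} {j = j} i<N j<N (inj₁ i≡) (inj₂ j≡) =
  ⊥-elim (<⇒≱ i<N (≤-trans (m≤n+m N j) (≤-reflexive (trans j≡ (sym i≡)))))
Ahead-unique {N} {i = i} i<N j<N (inj₂ i≡) (inj₁ j≡) =
  ⊥-elim (<⇒≱ j<N (≤-trans (m≤n+m N i) (≤-reflexive (trans i≡ (sym j≡)))))

Behind-mixed : ∀ {N s d i j} → j < N → i + 1 + d ≡ s → ¬ (j + 1 + d ≡ s + N)
Behind-mixed {N} {s} {d} {i} {j} j<N i+1+d≡s j+1+d≡s+N = <⇒≱ j<N (≤-trans (m≤n+m N i) (≤-reflexive (sym j≡i+N)))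
  where
  open ≡-Reasoning
  shift : ∀ i d N → i + 1 + d + N ≡ i + N + 1 + d
  shift = solve-∀
  j≡i+N : j ≡ i + N
  j≡i+N = +1+d-cancel (begin
    j + 1 + d      ≡⟨ j+1+d≡s+N ⟩
    s + N          ≡⟨ cong (_+ N) i+1+d≡s ⟨
    i + 1 + d + N  ≡⟨ shift i d N ⟩
    i + N + 1 + d  ∎)

Behind-unique : ∀ {N s d i j} → i < N → j < N → Behind N s d i → Behind N s d j → i ≡ j
Behind-unique i<N j<N (inj₁ i≡) (inj₁ j≡) = +1+d-cancel (trans i≡ (sym j≡))
Behind-unique i<N j<N (inj₂ i≡) (inj₂ j≡) = +1+d-cancel (trans i≡ (sym j≡))
Behind-unique i<N j<N (inj₁ i≡) (inj₂ j≡) = ⊥-elim (Behind-mixed j<N i≡ j≡)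
Behind-unique i<N j<N (inj₂ i≡) (inj₁ j≡) = ⊥-elim (Behind-mixed i<N j≡ i≡)

Ahead? : ∀ N s d i → Dec (Ahead N s d i)
Ahead? N s d i = i ≟ s + d ⊎-dec i + N ≟ s + d

Behind? : ∀ N s d i → Dec (Behind N s d i)
Behind? N s d i = i + 1 + d ≟ s ⊎-dec i + 1 + d ≟ s + N

∑𝟙Ahead≤1 : ∀ {m N} s d → m ≤ N → ∑[ i < m ] 𝟙 (Ahead? N s d (toℕ i)) ≤ 1
∑𝟙Ahead≤1 {N = N} s d m≤N =
  ∑𝟙≤1 (Ahead? N s d ∘ toℕ) λ a a′ →
    toℕ-injective (Ahead-unique {N} {s} {d} (<-≤-trans (toℕ<n _) m≤N) (<-≤-trans (toℕ<n _) m≤N) a a′)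

∑𝟙Behind≤1 : ∀ {m N} s d → m ≤ N → ∑[ i < m ] 𝟙 (Behind? N s d (toℕ i)) ≤ 1
∑𝟙Behind≤1 {N = N} s d m≤N =
  ∑𝟙≤1 (Behind? N s d ∘ toℕ) λ b b′ →
    toℕ-injective (Behind-unique {N} {s} {d} (<-≤-trans (toℕ<n _) m≤N) (<-≤-trans (toℕ<n _) m≤N) b b′)

[a⊓L]⊓[b⊓L]≡[a⊓b]⊓L : ∀ a b L → (a ⊓ L) ⊓ (b ⊓ L) ≡ (a ⊓ b) ⊓ L
[a⊓L]⊓[b⊓L]≡[a⊓b]⊓L a b L = trans (⊓-interchange a L b L) (cong ((a ⊓ b) ⊓_) (⊓-idem L))

-- The edges of G are numbered 0, …, m - 1 along a line or a cycle of length n, and δ i s is the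
-- distance from vertex s to edge number i.
module IndexedEdges {n} (G : Graph n) (G? : ∀ u v → Dec (G u v))
  (D : Fin n → Fin n → ℕ)
  (D≤ : ∀ {d u v} → Reach G d u v → D u v ≤ d)
  (Reach-D : ∀ u v → Reach G (D u v) u v)
  {m : ℕ} (m≤n : m ≤ n)
  (index : Fin n → Fin n → ℕ)
  (index< : ∀ (e : Edge G) → index (lo e) (hi e) < m)
  (index-injective : ∀ (e f : Edge G) → index (lo e) (hi e) ≡ index (lo f) (hi f) → lo e ≡ lo f × hi e ≡ hi f)
  (edgeAt : Fin m → Edge G)
  (index-edgeAt : ∀ i → index (lo (edgeAt i)) (hi (edgeAt i)) ≡ toℕ i)
  (δ : ℕ → ℕ → ℕ)
  (D-edge : ∀ (e : Edge G) v → D v (lo e) ⊓ D v (hi e) ≡ δ (index (lo e) (hi e)) (toℕ v))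
  (δ-inverse : ∀ {i s} → i < m → s < n → Ahead n s (δ i s) i ⊎ Behind n s (δ i s) i)
  (δ-window : ∀ {L p i} → L ≤ p → p + L ≤ m → i < m → δ i p ⊓ L ≡ lineDist i p ⊓ L) where

  open ExactDistance G D D≤ Reach-D

  edgeIndex : Edge G → ℕ
  edgeIndex e = index (lo e) (hi e)

  edgeDist≡δ : ∀ r e v → edgeDist r e v ≡ δ (edgeIndex e) (toℕ v) ⊓ suc r
  edgeDist≡δ r e v = trans ([a⊓L]⊓[b⊓L]≡[a⊓b]⊓L _ _ (suc r)) (cong (_⊓ suc r) (D-edge e v))

  lowerBound : ∀ {r S} → EdgeResolving G r S → 2 * m ≤ 3 * suc r * ∣ S ∣ + 2
  lowerBound {r} {S} resolving = CountingBound.2m≤3L∣S∣+2 S τ (λ _ _ → m⊓n≤n _ _) separated ≤2-at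
    where
    τ : Fin m → Fin n → ℕ
    τ i v = δ (toℕ i) (toℕ v) ⊓ suc r
    edgeDist-edgeAt : ∀ i v → edgeDist r (edgeAt i) v ≡ τ i v
    edgeDist-edgeAt i v = trans (edgeDist≡δ r (edgeAt i) v) (cong (λ x → δ x (toℕ v) ⊓ suc r) (index-edgeAt i))
    separated : ∀ {i j} → i ≢ j → ∃[ v ] (v ∈ S × τ i v ≢ τ j v)
    separated {i} {j} i≢j with EdgeResolving⇒Resolves resolving (edgeAt i) (edgeAt j) distinct
      where
      distinct : DistinctEdges (edgeAt i) (edgeAt j)
      distinct (lo≡ , hi≡) =
        i≢j (toℕ-injective (trans (sym (index-edgeAt i)) (trans (cong₂ index lo≡ hi≡) (index-edgeAt j))))
    ... | v , v∈S , dists≢ =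
      v , v∈S , λ τ≡ → dists≢ (trans (edgeDist-edgeAt i v) (trans τ≡ (sym (edgeDist-edgeAt j v))))
    ≤2-at : ∀ v d → d < suc r → ∑[ i < m ] 𝟙 (τ i v ≟ d) ≤ 2
    ≤2-at v d d<L = begin
        ∑[ i < m ] 𝟙 (τ i v ≟ d)                              ≤⟨ ∑-mono-≤ ahead-or-behind ⟩
        ∑[ i < m ] (𝟙 (ahead? i) + 𝟙 (behind? i))             ≡⟨ ∑-distrib-+ (𝟙 ∘ ahead?) (𝟙 ∘ behind?) ⟩
        ∑[ i < m ] 𝟙 (ahead? i) + ∑[ i < m ] 𝟙 (behind? i)    ≤⟨ +-mono-≤ (∑𝟙Ahead≤1 _ d m≤n) (∑𝟙Behind≤1 _ d m≤n) ⟩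
        2                                                      ∎
      where
      open ≤-Reasoning
      ahead? behind? : ∀ (i : Fin m) → Dec _
      ahead? i = Ahead? n (toℕ v) d (toℕ i)
      behind? i = Behind? n (toℕ v) d (toℕ i)
      ahead-or-behind : ∀ i → 𝟙 (τ i v ≟ d) ≤ 𝟙 (ahead? i) + 𝟙 (behind? i)
      ahead-or-behind i = 𝟙≤𝟙+𝟙 (τ i v ≟ d) (ahead? i) (behind? i) λ τ≡d →
        subst (λ x → Ahead n (toℕ v) x (toℕ i) ⊎ Behind n (toℕ v) x (toℕ i))
              (⊓-≡-below τ≡d d<L) (δ-inverse (toℕ<n i) (toℕ<n v))

  module Blocks (r B : ℕ) (3L≤m : 3 * suc r ≤ m) (m≤B*3L : m ≤ B * (3 * suc r)) where

    L : ℕ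
    L = suc r

    -- Block b consists of the 3L edges from blockStart b on; the last block is shifted to end at m.
    blockStart : ℕ → ℕ
    blockStart b = b * (3 * L) ⊓ (m ∸ 3 * L)

    blockEnd≤m : ∀ b → blockStart b + 3 * L ≤ m
    blockEnd≤m b = ≤-trans (+-monoˡ-≤ (3 * L) (m⊓n≤n _ _)) (≤-reflexive (m∸n+n≡m 3L≤m))

    inBlock : ∀ {i} → i < m → ∃[ b ] (b < B × blockStart b ≤ i × i < blockStart b + 3 * L)
    inBlock {i} i<m = b , m<n*o⇒m/o<n (<-≤-trans i<m m≤B*3L) , ≤-trans (m⊓n≤m _ _) (m/n*n≤m i (3 * L)) ,
                      before-end (⊓-sel (b * (3 * L)) (m ∸ 3 * L))
      where
      b = i / (3 * L)
      before-end : blockStart b ≡ b * (3 * L) ⊎ blockStart b ≡ m ∸ 3 * L → i < blockStart b + 3 * L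
      before-end (inj₁ ≡b*3L) rewrite ≡b*3L = begin-strict
        i                           ≡⟨ m≡m%n+[m/n]*n i (3 * L) ⟩
        i % (3 * L) + b * (3 * L)   <⟨ +-monoˡ-< (b * (3 * L)) (m%n<n i (3 * L)) ⟩
        3 * L + b * (3 * L)         ≡⟨ +-comm (3 * L) _ ⟩
        b * (3 * L) + 3 * L         ∎
        where open ≤-Reasoning
      before-end (inj₂ ≡m∸3L) rewrite ≡m∸3L = subst (i <_) (sym (m∸n+n≡m 3L≤m)) i<m

    blockEnd≤m′ : ∀ b → blockStart b + L + L + L ≤ m
    blockEnd≤m′ b = subst (_≤ m) (sym (+L+L+L≡+3L _ L)) (blockEnd≤m b)

    landmark₁ landmark₂ : ℕ → Fin n
    landmark₁ b = fromℕ< (<-≤-trans (<-trans (m<m+n _ z<s) (m<m+n _ z<s)) (≤-trans (blockEnd≤m′ b) m≤n))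
    landmark₂ b = fromℕ< (<-≤-trans (m<m+n _ z<s) (≤-trans (blockEnd≤m′ b) m≤n))

    landmarks : ℕ → Subset n
    landmarks zero = ∅
    landmarks (suc b) = landmarks b ∪ (⁅ landmark₁ b ⁆ ∪ ⁅ landmark₂ b ⁆)

    ∣landmarks∣≤ : ∀ b → ∣ landmarks b ∣ ≤ 2 * b
    ∣landmarks∣≤ zero = ≤-reflexive (∣⊥∣≡0 n)
    ∣landmarks∣≤ (suc b) = begin
      ∣ landmarks b ∪ (⁅ p ⁆ ∪ ⁅ q ⁆) ∣    ≤⟨ ∣p∪q∣≤∣p∣+∣q∣ (landmarks b) _ ⟩
      ∣ landmarks b ∣ + ∣ ⁅ p ⁆ ∪ ⁅ q ⁆ ∣  ≤⟨ +-mono-≤ (∣landmarks∣≤ b) (∣p∪q∣≤∣p∣+∣q∣ ⁅ p ⁆ ⁅ q ⁆) ⟩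
      2 * b + (∣ ⁅ p ⁆ ∣ + ∣ ⁅ q ⁆ ∣)      ≡⟨ cong₂ (λ x y → 2 * b + (x + y)) (∣⁅x⁆∣≡1 p) (∣⁅x⁆∣≡1 q) ⟩
      2 * b + 2                          ≡⟨ +-comm (2 * b) 2 ⟩
      2 + 2 * b                          ≡⟨ *-suc 2 b ⟨
      2 * suc b                          ∎
      where
      open ≤-Reasoning
      p = landmark₁ b
      q = landmark₂ b

    landmark₁∈ : ∀ {b c} → b < c → landmark₁ b ∈ landmarks c
    landmark₁∈ {b} {suc c} b<1+c with m<1+n⇒m<n∨m≡n b<1+c
    ... | inj₁ b<c = p⊆p∪q _ (landmark₁∈ b<c)
    ... | inj₂ refl = q⊆p∪q (landmarks b) _ (p⊆p∪q _ (x∈⁅x⁆ (landmark₁ b)))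

    landmark₂∈ : ∀ {b c} → b < c → landmark₂ b ∈ landmarks c
    landmark₂∈ {b} {suc c} b<1+c with m<1+n⇒m<n∨m≡n b<1+c
    ... | inj₁ b<c = p⊆p∪q _ (landmark₂∈ b<c)
    ... | inj₂ refl = q⊆p∪q (landmarks b) _ (q⊆p∪q ⁅ landmark₁ b ⁆ _ (x∈⁅x⁆ (landmark₂ b)))

    edgeDist-window : ∀ e v → L ≤ toℕ v → toℕ v + L ≤ m → edgeDist r e v ≡ lineDist (edgeIndex e) (toℕ v) ⊓ L
    edgeDist-window e v L≤v v+L≤m = trans (edgeDist≡δ r e v) (δ-window L≤v v+L≤m (index< e))

    edgeDist≡⇒lineDist≡ : ∀ {e f p} v → toℕ v ≡ p → L ≤ p → p + L ≤ m →
                          edgeDist r e v ≡ edgeDist r f v →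
                          lineDist (edgeIndex f) p ⊓ L ≡ lineDist (edgeIndex e) p ⊓ L
    edgeDist≡⇒lineDist≡ {e} {f} v refl L≤p p+L≤m ≡v =
      trans (sym (edgeDist-window f v L≤p p+L≤m)) (trans (sym ≡v) (edgeDist-window e v L≤p p+L≤m))

    resolves : Resolves r (landmarks B)
    resolves e f e≢f = within-block (inBlock (index< e))
      where
      within-block : ∃[ b ] (b < B × blockStart b ≤ edgeIndex e × edgeIndex e < blockStart b + 3 * L) →
                     ∃[ v ] (v ∈ landmarks B × edgeDist r e v ≢ edgeDist r f v)
      within-block (b , b<B , start≤i , i<end) =
        by-landmarks (edgeDist r e (landmark₁ b) ≟ edgeDist r f (landmark₁ b))
                     (edgeDist r e (landmark₂ b) ≟ edgeDist r f (landmark₂ b))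
        where
        a = blockStart b
        by-landmarks : Dec (edgeDist r e (landmark₁ b) ≡ edgeDist r f (landmark₁ b)) →
                       Dec (edgeDist r e (landmark₂ b) ≡ edgeDist r f (landmark₂ b)) →
                       ∃[ v ] (v ∈ landmarks B × edgeDist r e v ≢ edgeDist r f v)
        by-landmarks (no ≢₁) _ = landmark₁ b , landmark₁∈ b<B , ≢₁
        by-landmarks (yes _) (no ≢₂) = landmark₂ b , landmark₂∈ b<B , ≢₂
        by-landmarks (yes ≡₁) (yes ≡₂) = ⊥-elim (e≢f (index-injective e f (sym same-index)))
          where
          same-index : edgeIndex f ≡ edgeIndex e
          same-index = lineDist-pair-injective {a + L} {L} (lineDist-block start≤i i<end)
            (edgeDist≡⇒lineDist≡ {e} {f} (landmark₁ b) (toℕ-fromℕ< _) (m≤n+m L a)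
                       (≤-trans (m≤m+n (a + L + L) L) (blockEnd≤m′ b)) ≡₁)
            (edgeDist≡⇒lineDist≡ {e} {f} (landmark₂ b) (toℕ-fromℕ< _) (m≤n+m L (a + L)) (blockEnd≤m′ b) ≡₂)

  upperBound : ∀ {r B} → 3 * suc r ≤ m → m ≤ B * (3 * suc r) →
               ∃[ S ] (EdgeResolving G r S × ∣ S ∣ ≤ 2 * B)
  upperBound {r} {B} 3L≤m m≤B*3L = landmarks B , Resolves⇒EdgeResolving resolves , ∣landmarks∣≤ B
    where open Blocks r B 3L≤m m≤B*3L

  ThEdimWithin : ℕ → Set
  ThEdimWithin k = Σ ℕ (λ t → IsThEdim G t × WithinFactor k n t)

  -- With h = 2 + w ≈ √(n/6): range r = 2h - 1, so L = 2h, and h + 3 blocks of 6h edges; then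
  -- r + ∣S∣ ≤ 4h + 5.
  thEdim-withinFactor : ∀ k → n ≤ suc m → threshold k ≤ n → ThEdimWithin k
  thEdim-withinFactor k n≤1+m large = within (landmarkScale k n large)
    where
    within : ∃[ w ] (6 * (2 + w) ^ 2 ≤ n × n < 6 * (3 + w) ^ 2 × 2 * k ≤ w) → ThEdimWithin k
    within (w , 6h²≤n , n<6[h+1]² , 2k≤w) =
      conclude (upperBound {1 + w + (2 + w)} {5 + w} (proj₁ fits) (proj₂ fits))
      where
      fits : 3 * (2 + w + (2 + w)) ≤ m × m ≤ (5 + w) * (3 * (2 + w + (2 + w)))
      fits = blocks-fit m≤n n≤1+m 6h²≤n n<6[h+1]²
      conclude : ∃[ S ] (EdgeResolving G (1 + w + (2 + w)) S × ∣ S ∣ ≤ 2 * (5 + w)) → ThEdimWithin k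
      conclude (S₀ , resolving₀ , ∣S₀∣≤2B) = optimal (thEdim-exists G? resolving₀)
        where
        optimal : ∃[ t ] (IsThEdim G t × t ≤ 1 + w + (2 + w) + ∣ S₀ ∣) → ThEdimWithin k
        optimal (t , isThEdim@((r , _ , ((S , resolving , ∣S∣≡k′) , _) , t≡r+k′) , _) , t≤) =
          t , isThEdim , upperEstimate {k} 2k≤w 6h²≤n (cost≤4h+5 t≤ ∣S₀∣≤2B) ,
          subst (λ x → 8 * k ^ 2 * n ≤ 3 * suc k ^ 2 * x ^ 2) (sym (trans t≡r+k′ (cong (r +_) (sym ∣S∣≡k′))))
                (lowerEstimate {k} {r = r} {∣ S ∣} n≤1+m (lowerBound resolving) large)

-- Paths

∣x-1+x∣≡1 : ∀ x → ∣ x - suc x ∣ ≡ 1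
∣x-1+x∣≡1 zero = refl
∣x-1+x∣≡1 (suc x) = ∣x-1+x∣≡1 x

consecutive⇒∣-∣≡1 : ∀ {x y} → y ≡ suc x ⊎ x ≡ suc y → ∣ x - y ∣ ≡ 1
consecutive⇒∣-∣≡1 {x} (inj₁ refl) = ∣x-1+x∣≡1 x
consecutive⇒∣-∣≡1 {y = y} (inj₂ refl) = trans (∣-∣-comm (suc y) y) (∣x-1+x∣≡1 y)

∣-∣-step : ∀ a {b c} → ∣ b - c ∣ ≡ 1 → ∣ a - c ∣ ≤ suc ∣ a - b ∣
∣-∣-step a {b} {c} ∣b-c∣≡1 =
  ≤-trans (∣-∣-triangle a b c) (≤-reflexive (trans (cong (∣ a - b ∣ +_) ∣b-c∣≡1) (+-comm ∣ a - b ∣ 1)))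

module Path (m : ℕ) where

  n : ℕ
  n = suc m

  G : Graph n
  G = pathG n

  D : Fin n → Fin n → ℕ
  D u v = ∣ toℕ u - toℕ v ∣

  open Walks G using (Reach⇒≤; Reach-∣u-v∣)

  D≤ : ∀ {d u v} → Reach G d u v → D u v ≤ d
  D≤ = Reach⇒≤ D (λ u → ∣n-n∣≡0 (toℕ u)) (λ u w~v → ∣-∣-step (toℕ u) (consecutive⇒∣-∣≡1 w~v))

  Reach-D : ∀ u v → Reach G (D u v) u v
  Reach-D = Reach-∣u-v∣ symmetric inj₁
    where
    symmetric : ∀ {u v} → G u v → G v u
    symmetric (inj₁ v≡1+u) = inj₂ v≡1+u
    symmetric (inj₂ u≡1+v) = inj₁ u≡1+v

  G? : ∀ u v → Dec (G u v)
  G? u v = toℕ v ≟ suc (toℕ u) ⊎-dec toℕ u ≟ suc (toℕ v)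

  hi≡1+lo : ∀ (e : Edge G) → toℕ (hi e) ≡ suc (toℕ (lo e))
  hi≡1+lo (edge _ _ _ (inj₁ hi≡1+lo)) = hi≡1+lo
  hi≡1+lo (edge _ _ lo<hi (inj₂ lo≡1+hi)) = ⊥-elim (<-asym lo<hi (≤-reflexive (sym lo≡1+hi)))

  index : Fin n → Fin n → ℕ
  index l _ = toℕ l

  index< : ∀ (e : Edge G) → index (lo e) (hi e) < m
  index< e = ≤-pred (subst (_< n) (hi≡1+lo e) (toℕ<n (hi e)))

  index-injective : ∀ (e f : Edge G) → index (lo e) (hi e) ≡ index (lo f) (hi f) → lo e ≡ lo f × hi e ≡ hi f
  index-injective e f lo≡ =
    toℕ-injective lo≡ , toℕ-injective (trans (hi≡1+lo e) (trans (cong suc lo≡) (sym (hi≡1+lo f))))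

  edgeAt : Fin m → Edge G
  edgeAt i = edge (Fin.inject₁ i) (suc i) (≤-reflexive (cong suc (Finₚ.toℕ-inject₁ i)))
                  (inj₁ (cong suc (sym (Finₚ.toℕ-inject₁ i))))

  D-edge : ∀ (e : Edge G) v → D v (lo e) ⊓ D v (hi e) ≡ lineDist (index (lo e) (hi e)) (toℕ v)
  D-edge e v = cong (λ h → ∣ toℕ v - toℕ (lo e) ∣ ⊓ ∣ toℕ v - h ∣) (hi≡1+lo e)

  lineDist-inverse : ∀ {i s} → i < m → s < n → Ahead n s (lineDist i s) i ⊎ Behind n s (lineDist i s) i
  lineDist-inverse _ _ = [ inj₁ ∘ inj₁ , inj₂ ∘ inj₁ ]′ (lineDist≡⇒ refl)

  open IndexedEdges G G? D D≤ Reach-D (n≤1+n m) index index< index-injective edgeAt Finₚ.toℕ-inject₁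
                    lineDist D-edge lineDist-inverse (λ _ _ _ → refl)

  path-thEdim : ∀ k → threshold k ≤ n → Σ ℕ (λ t → IsThEdim G t × WithinFactor k n t)
  path-thEdim k = thEdim-withinFactor k ≤-refl

-- Cycles

∣x+z-y+z∣≡∣x-y∣ : ∀ x y z → ∣ x + z - (y + z) ∣ ≡ ∣ x - y ∣
∣x+z-y+z∣≡∣x-y∣ x y z rewrite +-comm x z | +-comm y z = ∣m+n-m+o∣≡∣n-o∣ z x y

x⊓[y⊓z]≡x⊓y : ∀ {x y z} → x ≤ z → x ⊓ (y ⊓ z) ≡ x ⊓ y
x⊓[y⊓z]≡x⊓y {x} {y} {z} x≤z = begin
  x ⊓ (y ⊓ z)   ≡⟨ cong (x ⊓_) (⊓-comm y z) ⟩
  x ⊓ (z ⊓ y)   ≡⟨ ⊓-assoc x z y ⟨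
  x ⊓ z ⊓ y     ≡⟨ cong (_⊓ y) (m≤n⇒m⊓n≡m x≤z) ⟩
  x ⊓ y         ∎
  where open ≡-Reasoning

x⊓[y⊓z]≡x⊓z : ∀ {x y z} → x ≤ y → x ⊓ (y ⊓ z) ≡ x ⊓ z
x⊓[y⊓z]≡x⊓z {x} {y} {z} x≤y = trans (sym (⊓-assoc x y z)) (cong (_⊓ z) (m≤n⇒m⊓n≡m x≤y))

∣x-a∣≤∣x-b∣ : ∀ {x a b} → x ≤ a → a ≤ b → ∣ x - a ∣ ≤ ∣ x - b ∣
∣x-a∣≤∣x-b∣ {x} x≤a a≤b rewrite m≤n⇒∣m-n∣≡n∸m x≤a | m≤n⇒∣m-n∣≡n∸m (≤-trans x≤a a≤b) = ∸-monoˡ-≤ x a≤b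

module Cycle (n′ : ℕ) (2≤n′ : 2 ≤ n′) where

  n : ℕ
  n = suc n′

  G : Graph n
  G = cycleG n

  -- Vertex y of C_n lifts to y and y + n on the line, and the cycle distance is the least line
  -- distance between lifts.
  cycleDist : ℕ → ℕ → ℕ
  cycleDist x y = ∣ x - y ∣ ⊓ (∣ x + n - y ∣ ⊓ ∣ x - (y + n) ∣)

  D : Fin n → Fin n → ℕ
  D u v = cycleDist (toℕ u) (toℕ v)

  open Walks G using (Reach⇒≤; Reach-++; Reach-sym; Reach-forward; Reach-∣u-v∣)

  ∣x-0∣≤∣x+n-0∣ : ∀ x → ∣ x - 0 ∣ ≤ ∣ x + n - 0 ∣
  ∣x-0∣≤∣x+n-0∣ x = subst₂ _≤_ (sym (∣-∣-identityʳ x)) (sym (∣-∣-identityʳ (x + n))) (m≤m+n x n)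

  cycleDist-n≡cycleDist-0 : ∀ {y} → y ≤ n → cycleDist y n ≡ cycleDist y 0
  cycleDist-n≡cycleDist-0 {y} y≤n = begin
    ∣ y - n ∣ ⊓ (∣ y + n - n ∣ ⊓ ∣ y - (n + n) ∣)  ≡⟨ x⊓[y⊓z]≡x⊓y (∣x-n∣≤∣x-n+n∣) ⟩
    ∣ y - n ∣ ⊓ ∣ y + n - n ∣                      ≡⟨ cong (∣ y - n ∣ ⊓_) (∣x+z-y+z∣≡∣x-y∣ y 0 n) ⟩
    ∣ y - n ∣ ⊓ ∣ y - 0 ∣                          ≡⟨ ⊓-comm _ _ ⟩
    ∣ y - 0 ∣ ⊓ ∣ y - n ∣                          ≡⟨ x⊓[y⊓z]≡x⊓z (∣x-0∣≤∣x+n-0∣ y) ⟨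
    ∣ y - 0 ∣ ⊓ (∣ y + n - 0 ∣ ⊓ ∣ y - n ∣)        ∎
    where
    open ≡-Reasoning
    ∣x-n∣≤∣x-n+n∣ : ∣ y - n ∣ ≤ ∣ y - (n + n) ∣
    ∣x-n∣≤∣x-n+n∣ = ∣x-a∣≤∣x-b∣ y≤n (m≤m+n n n)

  cycleDist≤₁ : ∀ x y → cycleDist x y ≤ ∣ x - y ∣
  cycleDist≤₁ x y = m⊓n≤m _ _

  cycleDist≤₂ : ∀ x y → cycleDist x y ≤ ∣ x + n - y ∣
  cycleDist≤₂ x y = ≤-trans (m⊓n≤n _ _) (m⊓n≤m _ _)

  cycleDist≤₃ : ∀ x y → cycleDist x y ≤ ∣ x - (y + n) ∣
  cycleDist≤₃ x y = ≤-trans (m⊓n≤n _ _) (m⊓n≤n _ _)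

  ∣n-n′∣≡1 : ∣ n - n′ ∣ ≡ 1
  ∣n-n′∣≡1 = trans (∣-∣-comm n n′) (∣x-1+x∣≡1 n′)

  ∣x+n-n∣≡∣x-0∣ : ∀ x → ∣ x + n - n ∣ ≡ ∣ x - 0 ∣
  ∣x+n-n∣≡∣x-0∣ x = ∣x+z-y+z∣≡∣x-y∣ x 0 n

  consecutive-step : ∀ x {z y} → ∣ z - y ∣ ≡ 1 → cycleDist x y ≤ suc (cycleDist x z)
  consecutive-step x {z} {y} ∣z-y∣≡1 =
    ⊓-glb (≤-trans (cycleDist≤₁ x y) (∣-∣-step x ∣z-y∣≡1))
          (⊓-glb (≤-trans (cycleDist≤₂ x y) (∣-∣-step (x + n) ∣z-y∣≡1))
                 (≤-trans (cycleDist≤₃ x y) (∣-∣-step x {z + n} (trans (∣x+z-y+z∣≡∣x-y∣ z y n) ∣z-y∣≡1))))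

  0→n′-step : ∀ x → cycleDist x n′ ≤ suc (cycleDist x 0)
  0→n′-step x =
    ⊓-glb via-x (⊓-glb (≤-trans via-x (s≤s (∣x-0∣≤∣x+n-0∣ x))) (≤-trans (cycleDist≤₁ x n′) (∣-∣-step x ∣n-n′∣≡1)))
    where
    via-x : cycleDist x n′ ≤ suc ∣ x - 0 ∣
    via-x = ≤-trans (cycleDist≤₂ x n′)
                    (subst (λ d → ∣ x + n - n′ ∣ ≤ suc d) (∣x+n-n∣≡∣x-0∣ x) (∣-∣-step (x + n) ∣n-n′∣≡1))

  n′→0-step : ∀ {x} → x ≤ n → cycleDist x 0 ≤ suc (cycleDist x n′)
  n′→0-step {x} x≤n =
    ⊓-glb (≤-trans (cycleDist≤₃ x 0) (∣-∣-step x (trans (∣-∣-comm n′ n) ∣n-n′∣≡1)))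
          (⊓-glb (≤-trans (cycleDist≤₁ x 0)
                          (subst (_≤ suc ∣ x + n - n′ ∣) (∣x+n-n∣≡∣x-0∣ x) (∣-∣-step (x + n) (∣x-1+x∣≡1 n′))))
                 (≤-trans (cycleDist≤₃ x 0) (≤-trans (∣x-a∣≤∣x-b∣ x≤n (m≤n+m n n′)) (n≤1+n ∣ x - (n′ + n) ∣))))

  D-step : ∀ u {w v} → G w v → D u v ≤ suc (D u w)
  D-step u (inj₁ v≡1+w) = consecutive-step (toℕ u) (consecutive⇒∣-∣≡1 (inj₁ v≡1+w))
  D-step u (inj₂ (inj₁ w≡1+v)) = consecutive-step (toℕ u) (consecutive⇒∣-∣≡1 (inj₂ w≡1+v))
  D-step u {w} {v} (inj₂ (inj₂ (inj₁ (w≡0 , 1+v≡n)))) rewrite w≡0 | suc-injective 1+v≡n = 0→n′-step (toℕ u)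
  D-step u {w} {v} (inj₂ (inj₂ (inj₂ (v≡0 , 1+w≡n)))) rewrite v≡0 | suc-injective 1+w≡n = n′→0-step (<⇒≤ (toℕ<n u))

  D≤ : ∀ {d u v} → Reach G d u v → D u v ≤ d
  D≤ = Reach⇒≤ D (λ u → cycleDist-refl (toℕ u)) D-step
    where
    cycleDist-refl : ∀ x → cycleDist x x ≡ 0
    cycleDist-refl x rewrite ∣n-n∣≡0 x = refl

  symmetric : ∀ {u v} → G u v → G v u
  symmetric (inj₁ v≡1+u) = inj₂ (inj₁ v≡1+u)
  symmetric (inj₂ (inj₁ u≡1+v)) = inj₁ u≡1+v
  symmetric (inj₂ (inj₂ (inj₁ wrap))) = inj₂ (inj₂ (inj₂ wrap))
  symmetric (inj₂ (inj₂ (inj₂ wrap))) = inj₂ (inj₂ (inj₁ wrap))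

  last : Fin n
  last = Fin.fromℕ n′

  Reach-around : ∀ u v → Reach G ∣ toℕ u + n - toℕ v ∣ u v
  Reach-around u v = subst (λ d → Reach G d u v) length
    (Reach-++ (x + 1) (n′ ∸ y) (Reach-++ x 1 u→0 0→last) last→v)
    where
    x = toℕ u
    y = toℕ v
    y≤n′ : y ≤ n′
    y≤n′ = ≤-pred (toℕ<n v)
    u→0 : Reach G x u zero
    u→0 = Reach-sym symmetric x (Reach-forward symmetric inj₁ x refl)
    0→last : Reach G 1 zero last
    0→last = inj₂ (zero , refl , inj₂ (inj₂ (inj₁ (refl , cong suc (Finₚ.toℕ-fromℕ n′)))))
    last→v : Reach G (n′ ∸ y) last v
    last→v = Reach-sym symmetric (n′ ∸ y)
      (Reach-forward symmetric inj₁ (n′ ∸ y) (trans (Finₚ.toℕ-fromℕ n′) (sym (m+[n∸m]≡n y≤n′))))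
    length : x + 1 + (n′ ∸ y) ≡ ∣ x + n - y ∣
    length = begin
      x + 1 + (n′ ∸ y)  ≡⟨ +-assoc x 1 (n′ ∸ y) ⟩
      x + suc (n′ ∸ y)  ≡⟨ cong (x +_) (+-∸-assoc 1 y≤n′) ⟨
      x + (n ∸ y)       ≡⟨ +-∸-assoc x (≤-trans y≤n′ (n≤1+n n′)) ⟨
      x + n ∸ y         ≡⟨ m≤n⇒∣m-n∣≡n∸m (≤-trans (≤-trans y≤n′ (n≤1+n n′)) (m≤n+m n x)) ⟨
      ∣ y - x + n ∣     ≡⟨ ∣-∣-comm y (x + n) ⟩
      ∣ x + n - y ∣     ∎
      where open ≡-Reasoning

  Reach-D : ∀ u v → Reach G (D u v) u v
  Reach-D u v with ⊓-sel ∣ toℕ u - toℕ v ∣ (∣ toℕ u + n - toℕ v ∣ ⊓ ∣ toℕ u - (toℕ v + n) ∣)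
  ... | inj₁ ≡direct = subst (λ d → Reach G d u v) (sym ≡direct) (Reach-∣u-v∣ symmetric inj₁ u v)
  ... | inj₂ ≡around with ⊓-sel ∣ toℕ u + n - toℕ v ∣ ∣ toℕ u - (toℕ v + n) ∣
  ...   | inj₁ ≡forward = subst (λ d → Reach G d u v) (sym (trans ≡around ≡forward)) (Reach-around u v)
  ...   | inj₂ ≡backward =
    subst (λ d → Reach G d u v) (sym (trans ≡around (trans ≡backward (∣-∣-comm (toℕ u) (toℕ v + n)))))
          (Reach-sym symmetric _ (Reach-around v u))

  G? : ∀ u v → Dec (G u v)
  G? u v = toℕ v ≟ suc (toℕ u) ⊎-dec toℕ u ≟ suc (toℕ v) ⊎-dec
           ((toℕ u ≟ 0 ×-dec suc (toℕ v) ≟ n) ⊎-dec (toℕ v ≟ 0 ×-dec suc (toℕ u) ≟ n))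

  edge-cases : ∀ (e : Edge G) → toℕ (hi e) ≡ suc (toℕ (lo e)) ⊎ (toℕ (lo e) ≡ 0 × toℕ (hi e) ≡ n′)
  edge-cases (edge _ _ _ (inj₁ hi≡1+lo)) = inj₁ hi≡1+lo
  edge-cases (edge _ _ lo<hi (inj₂ (inj₁ lo≡1+hi))) = ⊥-elim (<-asym lo<hi (≤-reflexive (sym lo≡1+hi)))
  edge-cases (edge _ _ _ (inj₂ (inj₂ (inj₁ (lo≡0 , 1+hi≡n))))) = inj₂ (lo≡0 , suc-injective 1+hi≡n)
  edge-cases (edge _ _ lo<hi (inj₂ (inj₂ (inj₂ (hi≡0 , _))))) = ⊥-elim (n≮0 (subst (_ <_) hi≡0 lo<hi))

  index : Fin n → Fin n → ℕ
  index l h with toℕ h ≟ suc (toℕ l)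
  ... | yes _ = toℕ l
  ... | no _ = n′

  index-consecutive : ∀ {l h} → toℕ h ≡ suc (toℕ l) → index l h ≡ toℕ l
  index-consecutive {l} {h} h≡1+l with toℕ h ≟ suc (toℕ l)
  ... | yes _ = refl
  ... | no h≢1+l = ⊥-elim (h≢1+l h≡1+l)

  index-wrap : ∀ {l h} → toℕ l ≡ 0 → toℕ h ≡ n′ → index l h ≡ n′
  index-wrap {l} {h} l≡0 h≡n′ with toℕ h ≟ suc (toℕ l)
  ... | yes h≡1+l = ⊥-elim (<⇒≢ 2≤n′ (sym (trans (sym h≡n′) (trans h≡1+l (cong suc l≡0)))))
  ... | no _ = refl

  consecutive⇒lo<n′ : ∀ (e : Edge G) → toℕ (hi e) ≡ suc (toℕ (lo e)) → toℕ (lo e) < n′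
  consecutive⇒lo<n′ e hi≡1+lo = ≤-pred (subst (_< n) hi≡1+lo (toℕ<n (hi e)))

  index< : ∀ (e : Edge G) → index (lo e) (hi e) < n
  index< e with edge-cases e
  ... | inj₁ hi≡1+lo = subst (_< n) (sym (index-consecutive hi≡1+lo)) (<-trans (lt e) (toℕ<n (hi e)))
  ... | inj₂ (lo≡0 , hi≡n′) = subst (_< n) (sym (index-wrap lo≡0 hi≡n′)) ≤-refl

  index-injective : ∀ (e f : Edge G) → index (lo e) (hi e) ≡ index (lo f) (hi f) → lo e ≡ lo f × hi e ≡ hi f
  index-injective e f same with edge-cases e | edge-cases f
  ... | inj₁ e-cons | inj₁ f-cons =
    toℕ-injective lo≡ , toℕ-injective (trans e-cons (trans (cong suc lo≡) (sym f-cons)))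
    where
    lo≡ = trans (sym (index-consecutive e-cons)) (trans same (index-consecutive f-cons))
  ... | inj₂ (e-lo , e-hi) | inj₂ (f-lo , f-hi) =
    toℕ-injective (trans e-lo (sym f-lo)) , toℕ-injective (trans e-hi (sym f-hi))
  ... | inj₁ e-cons | inj₂ (f-lo , f-hi) =
    ⊥-elim (<⇒≢ (consecutive⇒lo<n′ e e-cons)
                (trans (sym (index-consecutive e-cons)) (trans same (index-wrap f-lo f-hi))))
  ... | inj₂ (e-lo , e-hi) | inj₁ f-cons =
    ⊥-elim (<⇒≢ (consecutive⇒lo<n′ f f-cons)
                (trans (sym (index-consecutive f-cons)) (trans (sym same) (index-wrap e-lo e-hi))))

  edgeFrom : (i : Fin n) → Dec (toℕ i < n′) → Edge G
  edgeFrom i (yes i<n′) =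
    edge i (fromℕ< (s≤s i<n′)) (≤-reflexive (sym (toℕ-fromℕ< (s≤s i<n′)))) (inj₁ (toℕ-fromℕ< (s≤s i<n′)))
  edgeFrom i (no _) = edge zero last (subst (0 <_) (sym (Finₚ.toℕ-fromℕ n′)) (<-≤-trans z<s 2≤n′))
                           (inj₂ (inj₂ (inj₁ (refl , cong suc (Finₚ.toℕ-fromℕ n′)))))

  edgeAt : Fin n → Edge G
  edgeAt i = edgeFrom i (toℕ i <? n′)

  index-edgeAt : ∀ i → index (lo (edgeAt i)) (hi (edgeAt i)) ≡ toℕ i
  index-edgeAt i = index-edgeFrom (toℕ i <? n′)
    where
    index-edgeFrom : ∀ i<?n′ → index (lo (edgeFrom i i<?n′)) (hi (edgeFrom i i<?n′)) ≡ toℕ i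
    index-edgeFrom (yes i<n′) = index-consecutive (toℕ-fromℕ< (s≤s i<n′))
    index-edgeFrom (no i≮n′) =
      trans (index-wrap refl (Finₚ.toℕ-fromℕ n′)) (sym (≤-antisym (≤-pred (toℕ<n i)) (≮⇒≥ i≮n′)))

  δ : ℕ → ℕ → ℕ
  δ i y = lineDist i y ⊓ (lineDist i (y + n) ⊓ lineDist (i + n) y)

  consecutive-dist : ∀ y l → cycleDist y l ⊓ cycleDist y (suc l) ≡ δ l y
  consecutive-dist y l =
    trans (⊓-interchange ∣ y - l ∣ _ ∣ y - suc l ∣ _)
          (cong (lineDist l y ⊓_) (⊓-interchange ∣ y + n - l ∣ _ ∣ y + n - suc l ∣ _))

  D-edge : ∀ (e : Edge G) v → D v (lo e) ⊓ D v (hi e) ≡ δ (index (lo e) (hi e)) (toℕ v)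
  D-edge e v with edge-cases e
  ... | inj₁ hi≡1+lo = begin
      cycleDist y l ⊓ cycleDist y (toℕ (hi e))   ≡⟨ cong (λ h → cycleDist y l ⊓ cycleDist y h) hi≡1+lo ⟩
      cycleDist y l ⊓ cycleDist y (suc l)        ≡⟨ consecutive-dist y l ⟩
      δ l y                                      ≡⟨ cong (λ i → δ i y) (index-consecutive hi≡1+lo) ⟨
      δ (index (lo e) (hi e)) y                  ∎
    where
    open ≡-Reasoning
    y = toℕ v
    l = toℕ (lo e)
  ... | inj₂ (lo≡0 , hi≡n′) = begin
      cycleDist y (toℕ (lo e)) ⊓ cycleDist y (toℕ (hi e))   ≡⟨ cong₂ (λ l h → cycleDist y l ⊓ cycleDist y h) lo≡0 hi≡n′ ⟩
      cycleDist y 0 ⊓ cycleDist y n′                        ≡⟨ ⊓-comm _ _ ⟩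
      cycleDist y n′ ⊓ cycleDist y 0
        ≡⟨ cong (cycleDist y n′ ⊓_) (cycleDist-n≡cycleDist-0 (<⇒≤ (toℕ<n v))) ⟨
      cycleDist y n′ ⊓ cycleDist y n                        ≡⟨ consecutive-dist y n′ ⟩
      δ n′ y                                                ≡⟨ cong (λ i → δ i y) (index-wrap lo≡0 hi≡n′) ⟨
      δ (index (lo e) (hi e)) y                             ∎
    where
    open ≡-Reasoning
    y = toℕ v

  δ-inverse : ∀ {i s} → i < n → s < n → Ahead n s (δ i s) i ⊎ Behind n s (δ i s) i
  δ-inverse {i} {s} i<n s<n with ⊓-sel (lineDist i s) (lineDist i (s + n) ⊓ lineDist (i + n) s)
  ... | inj₁ ≡direct with lineDist≡⇒ (sym ≡direct)
  ...   | inj₁ i≡s+d = inj₁ (inj₁ i≡s+d)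
  ...   | inj₂ i+1+d≡s = inj₂ (inj₁ i+1+d≡s)
  δ-inverse {i} {s} i<n s<n | inj₂ ≡lifted with ⊓-sel (lineDist i (s + n)) (lineDist (i + n) s)
  ...   | inj₁ ≡up with lineDist≡⇒ (sym (trans ≡lifted ≡up))
  ...     | inj₁ i≡s+n+d = ⊥-elim (<⇒≱ i<n (subst (n ≤_) (sym i≡s+n+d) (≤-trans (m≤n+m n s) (m≤m+n (s + n) _))))
  ...     | inj₂ i+1+d≡s+n = inj₂ (inj₂ i+1+d≡s+n)
  δ-inverse {i} {s} i<n s<n | inj₂ ≡lifted | inj₂ ≡down with lineDist≡⇒ (sym (trans ≡lifted ≡down))
  ...     | inj₁ i+n≡s+d = inj₁ (inj₂ i+n≡s+d)
  ...     | inj₂ i+n+1+d≡s =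
    ⊥-elim (<⇒≱ s<n (subst (n ≤_) i+n+1+d≡s (≤-trans (m≤n+m n i) (≤-trans (m≤m+n (i + n) 1) (m≤m+n _ _)))))

  δ-window : ∀ {L p i} → L ≤ p → p + L ≤ n → i < n → δ i p ⊓ L ≡ lineDist i p ⊓ L
  δ-window {L} {p} {i} L≤p p+L≤n i<n =
    trans (⊓-assoc (lineDist i p) _ L) (cong (lineDist i p ⊓_) (m≥n⇒m⊓n≡n (⊓-glb far-above far-below)))
    where
    far-above : L ≤ lineDist i (p + n)
    far-above = lineDist-≥-left (≤-trans (+-mono-≤ i<n L≤p) (≤-reflexive (+-comm n p)))
    far-below : L ≤ lineDist (i + n) p
    far-below = lineDist-≥-right (≤-trans p+L≤n (m≤n+m n i))

  open IndexedEdges G G? D D≤ Reach-D ≤-refl index index< index-injective edgeAt index-edgeAt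
                    δ D-edge δ-inverse δ-window

  cycle-thEdim : ∀ k → threshold k ≤ n → Σ ℕ (λ t → IsThEdim G t × WithinFactor k n t)
  cycle-thEdim k = thEdim-withinFactor k (n≤1+n n)

mainTheorem18 : ((k : ℕ) → ∃[ N ] ((n : ℕ) → 3 ≤ n → N ≤ n →
    Σ ℕ (λ t → IsThEdim (cycleG n) t × WithinFactor k n t)))
    ×
    ((k : ℕ) → ∃[ N ] ((n : ℕ) → 3 ≤ n → N ≤ n →
    Σ ℕ (λ t → IsThEdim (pathG n) t × WithinFactor k n t)))
mainTheorem18 = (λ k → threshold k , cycle k) , (λ k → threshold k , path k)
  where
  cycle : ∀ k n → 3 ≤ n → threshold k ≤ n → Σ ℕ (λ t → IsThEdim (cycleG n) t × WithinFactor k n t)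
  cycle k (suc n′) (s≤s 2≤n′) = Cycle.cycle-thEdim n′ 2≤n′ k
  path : ∀ k n → 3 ≤ n → threshold k ≤ n → Σ ℕ (λ t → IsThEdim (pathG n) t × WithinFactor k n t)
  path k (suc m) _ = Path.path-thEdim m k
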